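{- Let $\Gamma$ be a connected graph with $n$ vertices. 1. If $\Gamma$ is not bipartite, then $H^{i,\le j}_{\Phi+d}(\Gamma)=0$ for all $i$ and $j$. 2. If $\Gamma$ is bipartite, then $H^{i,\le j}_{\Phi+d}(\Gamma)=0$ for all $i\ge1$ and all $j$. Moreover: - $H^{0,\le n}_{\Phi+d}(\Gamma)=H^0_{\Phi+d}(\Gamma)\cong\mathbb{Q}^2$; - $H^{0,\le n-1}_{\Phi+d}(\Gamma)\cong\mathbb{Q}$; - $H^{0,\le n-2}_{\Phi+d}(\Gamma)=0$.
   Context: Let $\Gamma$ be a finite graph with totally ordered edges. States. A state is a spanning subgraph $s$ (all vertices, a subset of the edges). Its dimension is its number of edges. An enhanced state labels each connected component of $s$ by $1$ or $x$. Its degree is the number of $x$-labels. Cochain groups. $C^{i,j}(\Gamma)$ is the $\mathbb{Q}$-vector space with basis the enhanced states of dimension $i$ and degree $j$, and $C^i=\bigoplus_j C^{i,j}$. The operator $\Phi+d$. Let $n(s,e)$ be the number of edges of $s$ smaller than $e$, and set $(\Phi+d)(S)=\sum_{e\notin s}(-1)^{n(s,e)}T_e$. Here: - if $e$ has both endpoints in one component of $s$, then $T_e$ is the enhanced state on $s\cup\{e\}$ with the same labels; - if $e$ joins distinct components labelled $a,b$, then the merged component gets label $ab$ computed in $\mathbb{Q}[x]/(x^2-1)$ ($1\cdot 1=1$, $1\cdot x=x\cdot 1=x$, $x\cdot x=1$), other labels unchanged. It is a differential and the sum of two maps: - the chromatic differential $d$ of bidegree $(1,0)$, which uses $x\cdot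 x=0$; - the map $\Phi$ of bidegree $(1,-2)$, which consists of the terms merging two $x$-labelled components into one labelled $1$. Filtration. Let $C^{i,\le j}(\Gamma)=\bigoplus_{k\le j}C^{i,k}(\Gamma)$. This filtration is preserved by $\Phi+d$. Define $H^{i,\le j}_{\Phi+d}(\Gamma)$ as the image of the map $H^i(C^{*,\le j}(\Gamma),\Phi+d)\to H^i(C^*(\Gamma),\Phi+d)=H^i_{\Phi+d}(\Gamma)$ induced by inclusion. -}

module Defs where

open import Data.Bool using (Bool; true; false; _∧_; _∨_; not; _xor_; if_then_else_)
open import Data.Nat as ℕ using (ℕ; zero; suc)
open import Data.Fin using (Fin; toℕ)
open import Data.Fin.Properties using () renaming (_≟_ to _≟ᶠ_)
open import Data.Integer as ℤ using (ℤ; +_)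
open import Data.Rational as ℚ using (ℚ; 0ℚ; 1ℚ)
open import Data.Vec as V using (Vec; []; _∷_; lookup; tabulate; _[_]≔_)
open import Data.Vec.Properties using (≡-dec)
open import Data.Bool.Properties using () renaming (_≟_ to _≟ᵇ_)
open import Data.List as L using (List; []; _∷_; allFin; concatMap; foldr)
open import Data.Bool.ListAction using (any; all)
open import Data.Product using (Σ; ∃; _×_; _,_; proj₁; proj₂)
open import Data.Sum using (_⊎_)
open import Data.Maybe using (Maybe; just; nothing)
open import Data.Unit using (⊤)
open import Relation.Nullary using (¬_; yes; no)
open import Relation.Nullary.Decidable using (⌊_⌋)
open import Relation.Binary.PropositionalEquality using (_≡_; _≢_)
open import Relation.Binary.Construct.Closure.ReflexiveTransitive using (Star)

-- Finite graphs: n vertices, m edges totally ordered by their index in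
-- Fin m; edge e has endpoints src e and tgt e (loops / multi-edges allowed).

record Graph (n m : ℕ) : Set where
  field
    src : Fin m → Fin n
    tgt : Fin m → Fin n
open Graph public

Adj : ∀ {n m} → Graph n m → Fin n → Fin n → Set
Adj Γ u v = ∃ λ e → (src Γ e ≡ u × tgt Γ e ≡ v) ⊎ (src Γ e ≡ v × tgt Γ e ≡ u)

Connected : ∀ {n m} → Graph n m → Set
Connected {n} Γ = (1 ℕ.≤ n) × (∀ u v → Star (Adj Γ) u v)

Bipartite : ∀ {n m} → Graph n m → Set
Bipartite Γ = Σ (Fin _ → Bool) λ c → ∀ e → c (src Γ e) ≢ c (tgt Γ e)

-- A state is a subset of edges (Vec Bool m).  An enhanced state is given by a
-- state together with a vertex labelling (true = x, false = 1) that is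
-- constant on the connected components of the state ("Valid").
-- Pairs (s , ℓ) that are not Valid are not basis elements: cochains are
-- required to vanish on them.

Sub : ℕ → Set
Sub k = Vec Bool k

PreState : ℕ → ℕ → Set
PreState n m = Sub m × Sub n

Valid : ∀ {n m} → Graph n m → PreState n m → Set
Valid Γ (s , ℓ) = ∀ e → lookup s e ≡ true → lookup ℓ (src Γ e) ≡ lookup ℓ (tgt Γ e)

allSub : (k : ℕ) → List (Sub k)
allSub zero = [] ∷ []
allSub (suc k) = concatMap (λ v → (false ∷ v) ∷ (true ∷ v) ∷ []) (allSub k)

allPre : (n m : ℕ) → List (PreState n m)
allPre n m = concatMap (λ s → L.map (s ,_) (allSub n)) (allSub m)

validᵇ : ∀ {n m} → Graph n m → PreState n m → Bool
validᵇ {m = m} Γ (s , ℓ) =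
  all (λ e → not (lookup s e) ∨ ⌊ lookup ℓ (src Γ e) ≟ᵇ lookup ℓ (tgt Γ e) ⌋) (allFin m)

-- connected component of u in the spanning subgraph with edge set s,
-- computed as the n-fold iteration of "add all s-neighbours"
step : ∀ {n m} → Graph n m → Sub m → Sub n → Sub n
step {m = m} Γ s R = tabulate λ w → lookup R w ∨
  any (λ e → lookup s e ∧
         ((lookup R (src Γ e) ∧ ⌊ tgt Γ e ≟ᶠ w ⌋) ∨ (lookup R (tgt Γ e) ∧ ⌊ src Γ e ≟ᶠ w ⌋)))
      (allFin m)

iter : ∀ {A : Set} → ℕ → (A → A) → A → A
iter zero f a = a
iter (suc k) f a = f (iter k f a)

comp : ∀ {n m} → Graph n m → Sub m → Fin n → Sub n
comp {n} Γ s u = iter n (step Γ s) (tabulate λ w → ⌊ u ≟ᶠ w ⌋)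

count : ∀ {k} → (Fin k → Bool) → ℕ
count {k} p = foldr (λ i c → if p i then suc c else c) 0 (allFin k)

dim : ∀ {n m} → PreState n m → ℕ
dim (s , ℓ) = count (lookup s)

-- degree = number of components labelled x; each component is counted at its
-- least vertex
isRep : ∀ {n m} → Graph n m → Sub m → Fin n → Bool
isRep {n} Γ s v = all (λ w → not (⌊ toℕ w ℕ.<? toℕ v ⌋ ∧ lookup (comp Γ s v) w)) (allFin n)

deg : ∀ {n m} → Graph n m → PreState n m → ℕ
deg Γ (s , ℓ) = count (λ v → lookup ℓ v ∧ isRep Γ s v)

-- T_e: add edge e; if it merges two components labelled a , b the merged
-- component gets a·b in Q[x]/(x²-1), i.e. a xor b (x ↔ true)
addEdge : ∀ {n m} → Graph n m → PreState n m → Fin m → PreState n m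
addEdge Γ (s , ℓ) e =
  let u = src Γ e ; v = tgt Γ e ; Cu = comp Γ s u ; Cv = comp Γ s v in
  (s [ e ]≔ true) ,
  (if lookup Cu v then ℓ
   else tabulate λ w → if lookup Cu w ∨ lookup Cv w
                       then lookup ℓ u xor lookup ℓ v else lookup ℓ w)

nse : ∀ {m} → Sub m → Fin m → ℕ
nse s e = count (λ f → lookup s f ∧ ⌊ toℕ f ℕ.<? toℕ e ⌋)

sign : ℕ → ℚ
sign zero = 1ℚ
sign (suc k) = ℚ.- sign k

Cochain : ℕ → ℕ → Set
Cochain n m = PreState n m → ℚ

_≈_ : ∀ {n m} → Cochain n m → Cochain n m → Set
f ≈ g = ∀ S → f S ≡ g S

0c : ∀ {n m} → Cochain n m
0c _ = 0ℚ

_-c_ : ∀ {n m} → Cochain n m → Cochain n m → Cochain n m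
(f -c g) S = f S ℚ.- g S

sumℚ : List ℚ → ℚ
sumℚ = foldr ℚ._+_ 0ℚ

-- the operator Φ+d, extended linearly from enhanced states:
-- (Φ+d)(S) = Σ_{e∉s} (-1)^{n(s,e)} T_e
D : ∀ {n m} → Graph n m → Cochain n m → Cochain n m
D {n} {m} Γ f T = sumℚ (concatMap (λ S →
    if validᵇ Γ S
    then L.map (λ e → if not (lookup (proj₁ S) e) ∧ ⌊ ≡-dec _≟ᵇ_ (proj₁ (addEdge Γ S e)) (proj₁ T) ⌋
                                                    ∧ ⌊ ≡-dec _≟ᵇ_ (proj₂ (addEdge Γ S e)) (proj₂ T) ⌋
                      then f S ℚ.* sign (nse (proj₁ S) e) else 0ℚ)
               (allFin m)
    else []) (allPre n m))

DegOK : Maybe ℤ → ℕ → Set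
DegOK nothing  d = ⊤
DegOK (just j) d = (+ d) ℤ.≤ j

InC : ∀ {n m} → Graph n m → ℕ → Maybe ℤ → Cochain n m → Set
InC Γ i b f = ∀ S → f S ≡ 0ℚ ⊎ (Valid Γ S × dim S ≡ i × DegOK b (deg Γ S))

Z : ∀ {n m} → Graph n m → ℕ → Maybe ℤ → Cochain n m → Set
Z Γ i b f = InC Γ i b f × (D Γ f ≈ 0c)

B : ∀ {n m} → Graph n m → ℕ → Cochain n m → Set
B Γ zero    f = f ≈ 0c
B Γ (suc i) f = ∃ λ u → InC Γ i nothing u × (D Γ u ≈ f)

-- H^{i,≤j}_{Φ+d}(Γ) = image of H^i(C^{*,≤j}) → H^i(C^*) is (Z^i ∩ C^{i,≤j})
-- modulo B^i(C): elements are Z Γ i (just j), two being equal iff their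
-- difference is in B Γ i.  With bound `nothing` this is H^i_{Φ+d}(Γ).

HZero : ∀ {n m} → Graph n m → ℕ → Maybe ℤ → Set
HZero Γ i b = ∀ f → Z Γ i b f → B Γ i f

HFull : ∀ {n m} → Graph n m → ℕ → Maybe ℤ → Set
HFull Γ i b = ∀ f → Z Γ i nothing f → ∃ λ g → Z Γ i b g × B Γ i (f -c g)

-- a ℚ-linear isomorphism ℚ^k ≅ H^{i,≤j}
_·c_ : ∀ {n m} → ℚ → Cochain n m → Cochain n m
(c ·c f) S = c ℚ.* f S

_+c_ : ∀ {n m} → Cochain n m → Cochain n m → Cochain n m
(f +c g) S = f S ℚ.+ g S

HIso : ∀ {n m} → Graph n m → ℕ → Maybe ℤ → ℕ → Set
HIso {n} {m} Γ i b k = Σ ((Fin k → ℚ) → Cochain n m) λ g →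
    (∀ a → Z Γ i b (g a))
  × (∀ a a' → B Γ i (g (λ t → a t ℚ.+ a' t) -c (g a +c g a')))
  × (∀ c a → B Γ i (g (λ t → c ℚ.* a t) -c (c ·c g a)))
  × (∀ a → B Γ i (g a) → ∀ t → a t ≡ 0ℚ)
  × (∀ f → Z Γ i b f → ∃ λ a → B Γ i (f -c g a))

{-# OPTIONS --safe #-}
-- Over ℚ the ring ℚ[x]/(x² − 1) splits as ℚ × ℚ through the idempotents e± = (1 ± x)/2, so labelling
-- the components of a state by these idempotents instead of by 1 and x is a change of basis of
-- the enhanced states. In the new basis an enhanced state is a spanning subgraph s together with
-- a vertex colouring c constant on the components of s, and T_e keeps c when c is constant across
-- e and gives 0 otherwise. Hence, colouring by colouring, Φ + d becomes the simplicial coboundary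
-- of the full simplex on the edges that are monochromatic for c. When such an edge exists this
-- complex is contractible (cone on that edge); when it does not, c is a proper 2-colouring and
-- only the empty state survives, in degree 0. So all cohomology in positive degree vanishes, and
-- H⁰ has one generator per proper 2-colouring: none if Γ is not bipartite, and two, c₀ and its
-- complement, if Γ is connected and bipartite. Written back at the empty state in the basis 1, x,
-- a combination of the two generators has degree ≤ n − 1 iff it vanishes on the all-x state,
-- which leaves a line; degree ≤ n − 2 also forces vanishing on a state of degree n − 1, where the
-- two generators enter with the opposite relative sign, which leaves 0.
module Submission where

open import Defs
open import Data.Bool using (Bool; true; false; _∧_; _∨_; not; _xor_; if_then_else_)
open import Data.Bool.Properties
  using (T-≡; ⇔→≡; ¬-not; ∧-comm; ∧-identityʳ; ∧-zeroʳ; ∧-conicalˡ; ∧-conicalʳ; ∨-zeroʳ; not-distribʳ-xor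
        ; xor-assoc; xor-same; xor-identityʳ; xor-inverseʳ; xor-∧-commutativeRing)
  renaming (_≟_ to _≟ᵇ_)
open import Algebra.Bundles using (CommutativeRing)
open import Algebra.Properties.CommutativeSemigroup (CommutativeRing.+-commutativeSemigroup xor-∧-commutativeRing)
  using () renaming (interchange to xor-interchange)
open import Data.Bool.ListAction using (all; any; and)
open import Data.Empty using (⊥-elim)
open import Data.Fin using (Fin; toℕ) renaming (zero to fz; suc to fs)
open import Data.Fin.Subset using (Subset; _∈_; _∉_; _⊆_; Nonempty; ∣_∣)
open import Data.Fin.Subset.Properties using (p⊂q⇒∣p∣<∣q∣; x∈p⇒∣p-x∣<∣p∣; ∣p∣≤n)
open import Data.Fin.Properties using (suc-injective; toℕ-injective; any?) renaming (_≟_ to _≟ᶠ_)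
open import Data.Maybe using (Maybe; just; nothing)
open import Data.Unit using (tt)
open import Data.List as L using (List; []; _∷_; _++_; allFin; concatMap; foldr)
open import Data.List.Membership.Propositional using (lose)
open import Data.List.Membership.Propositional.Properties using (∈-allFin)
open import Data.List.Properties using (map-tabulate; map-cong; foldr-map)
import Data.List.Relation.Unary.All as All
open import Data.List.Relation.Unary.All.Properties using (all⁺; all⁻)
open import Data.List.Relation.Unary.Any using (satisfied)
open import Data.List.Relation.Unary.Any.Properties using (any⁺; any⁻)
import Data.Integer as ℤ
import Data.Integer.Properties as ℤP
open import Data.Nat as ℕ using (ℕ; zero; suc; _≤_; z≤n; s≤s)
import Data.Nat.Properties as ℕP
open import Data.Product using (∃; _×_; _,_; proj₁; proj₂)
open import Data.Rational as ℚ using (ℚ; 0ℚ; 1ℚ; _+_; _*_; -_)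
import Data.Rational.Properties as ℚP
open import Data.Rational.Solver using (module +-*-Solver)
open import Data.Sum using (_⊎_; inj₁; inj₂)
open import Data.Vec as V using (Vec; []; _∷_; lookup; tabulate; _[_]≔_; replicate)
open import Data.Vec.Properties
  using (≡-dec; lookup∘tabulate; lookup-replicate; lookup-zipWith; lookup∘update; lookup∘update′; []=⇒lookup; lookup⇒[]=
        ; tabulate∘lookup; tabulate-cong; []≔-idempotent; []≔-lookup; []≔-commutes)
open import Function using (_∘_; id; Equivalence; mk⇔)
open import Relation.Binary.Construct.Closure.ReflexiveTransitive using (Star; ε; _◅_; _◅◅_)
open import Relation.Binary.PropositionalEquality
open import Relation.Nullary using (¬_; yes; no; Dec)
open import Relation.Binary.Definitions using (tri<; tri≈; tri>)
open import Relation.Nullary.Decidable using (⌊_⌋; ¬?; toWitness; isYes≗does; does-⇔; dec-true; dec-false; decidable-stable)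

open +-*-Solver using (solve; _:=_; _:+_; _:*_; :-_; con)
open Equivalence using (to; from)

private
  variable
    X Y : Set

-- Booleans, Boolean vectors and folds over Fin

⌊⌋-true⇒ : ∀ {P : Set} (d : Dec P) → ⌊ d ⌋ ≡ true → P
⌊⌋-true⇒ d h = toWitness (T-≡ .from h)

⌊⌋-yes : ∀ {P : Set} (d : Dec P) → P → ⌊ d ⌋ ≡ true
⌊⌋-yes d p = trans (isYes≗does d) (dec-true d p)

⌊⌋-no : ∀ {P : Set} (d : Dec P) → ¬ P → ⌊ d ⌋ ≡ false
⌊⌋-no d ¬p = trans (isYes≗does d) (dec-false d ¬p)

false≢true : false ≢ true
false≢true ()

bool-ext : ∀ {a b : Bool} → (a ≡ true → b ≡ true) → (b ≡ true → a ≡ true) → a ≡ b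
bool-ext f g = ⇔→≡ (mk⇔ f g)

∧-true⇒ : ∀ {a b} → a ∧ b ≡ true → a ≡ true × b ≡ true
∧-true⇒ {a} {b} h = ∧-conicalˡ a b h , ∧-conicalʳ a b h

∨-true⇒ : ∀ {a b} → a ∨ b ≡ true → a ≡ true ⊎ b ≡ true
∨-true⇒ {true}  _ = inj₁ refl
∨-true⇒ {false} h = inj₂ h

_≡ᵇ_ : Bool → Bool → Bool
a ≡ᵇ b = ⌊ a ≟ᵇ b ⌋

≡ᵇ-as-xor : ∀ a b → (a ≡ᵇ b) ≡ not (a xor b)
≡ᵇ-as-xor true  true  = refl
≡ᵇ-as-xor true  false = refl
≡ᵇ-as-xor false true  = refl
≡ᵇ-as-xor false false = refl

xor-xor : ∀ a x → (a xor x) xor x ≡ a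
xor-xor a x = trans (xor-assoc a x x) (trans (cong (a xor_) (xor-same x)) (xor-identityʳ a))

xor-cancelˡ : ∀ a b → a xor (a xor b) ≡ b
xor-cancelˡ a b = trans (sym (xor-assoc a a b)) (cong (_xor b) (xor-same a))

xor-cancelʳ : ∀ x {a b} → a xor x ≡ b xor x → a ≡ b
xor-cancelʳ x {a} {b} h = trans (sym (xor-xor a x)) (trans (cong (_xor x) h) (xor-xor b x))

xor-injectiveˡ : ∀ b {x y} → b xor x ≡ b xor y → x ≡ y
xor-injectiveˡ b {x} {y} h = trans (sym (xor-cancelˡ b x)) (trans (cong (b xor_) h) (xor-cancelˡ b y))

∧-not : ∀ a c → a ∧ not c ≡ (a ∧ c) xor a
∧-not true  true  = refl
∧-not true  false = refl
∧-not false c     = refl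

xor-shape : ∀ b x y g r → (b ∧ x) xor (((b xor g) ∧ y) xor r) ≡ (b ∧ (x xor y)) xor ((g ∧ y) xor r)
xor-shape false x y g     r = refl
xor-shape true  x y false r = sym (xor-assoc x y r)
xor-shape true  x y true  r = sym (trans (xor-assoc x y (y xor r)) (cong (x xor_) (xor-cancelˡ y r)))

all-allFin⁺ : ∀ {k} (p : Fin k → Bool) → all p (allFin k) ≡ true → ∀ i → p i ≡ true
all-allFin⁺ p h i = T-≡ .to (All.lookup (all⁺ p _ (T-≡ .from h)) (∈-allFin i))

all-allFin⁻ : ∀ {k} (p : Fin k → Bool) → (∀ i → p i ≡ true) → all p (allFin k) ≡ true
all-allFin⁻ {k} p h = T-≡ .to (all⁻ p {xs = allFin k} (All.tabulate (λ {i} _ → T-≡ .from (h i))))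

all-allFin-suc : ∀ {k} (p : Fin (suc k) → Bool) → all p (allFin (suc k)) ≡ p fz ∧ all (p ∘ fs) (allFin k)
all-allFin-suc p = cong (λ bs → p fz ∧ and bs) (trans (map-tabulate fs p) (sym (map-tabulate id (p ∘ fs))))

any-allFin⁺ : ∀ {k} (p : Fin k → Bool) → any p (allFin k) ≡ true → ∃ λ i → p i ≡ true
any-allFin⁺ {k} p h with i , pᵢ ← satisfied (any⁻ p (allFin k) (T-≡ .from h)) = i , T-≡ .to pᵢ

any-allFin⁻ : ∀ {k} (p : Fin k → Bool) i → p i ≡ true → any p (allFin k) ≡ true
any-allFin⁻ {k} p i h = T-≡ .to (any⁺ {xs = allFin k} p (lose (∈-allFin i) (T-≡ .from h)))

_<ᶠ_ : ∀ {k} → Fin k → Fin k → Bool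
y <ᶠ w = ⌊ toℕ y ℕ.<? toℕ w ⌋

<ᶠ-fs : ∀ {k} (y w : Fin k) → (fs y <ᶠ fs w) ≡ (y <ᶠ w)
<ᶠ-fs y w = trans (isYes≗does _) (trans (does-⇔ (mk⇔ ℕ.s<s⁻¹ ℕ.s<s) (toℕ (fs y) ℕ.<? toℕ (fs w)) (toℕ y ℕ.<? toℕ w)) (sym (isYes≗does _)))

ind : Bool → ℕ
ind b = if b then 1 else 0

<ᶠ-exclusive : ∀ {k} (a b : Fin k) → a ≢ b → ind (a <ᶠ b) ℕ.+ ind (b <ᶠ a) ≡ 1
<ᶠ-exclusive a b a≢b with ℕP.<-cmp (toℕ a) (toℕ b)
... | tri< a<b _ _ rewrite ⌊⌋-yes (toℕ a ℕ.<? toℕ b) a<b | ⌊⌋-no (toℕ b ℕ.<? toℕ a) (ℕP.<-asym a<b) = refl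
... | tri≈ _ a≡b _ = ⊥-elim (a≢b (toℕ-injective a≡b))
... | tri> _ _ b<a rewrite ⌊⌋-no (toℕ a ℕ.<? toℕ b) (ℕP.<-asym b<a) | ⌊⌋-yes (toℕ b ℕ.<? toℕ a) b<a = refl

isLeastIn : ∀ {k} → (Fin k → Bool) → Fin k → Bool
isLeastIn {k} K w = all (λ y → not (y <ᶠ w ∧ K y)) (allFin k)

isLeastIn-cong : ∀ {k} {K K′ : Fin k → Bool} → (∀ y → K y ≡ K′ y) → ∀ w → isLeastIn K w ≡ isLeastIn K′ w
isLeastIn-cong {k} h w = cong and (map-cong (λ y → cong (λ b → not (y <ᶠ w ∧ b)) (h y)) (allFin k))

isLeastIn-fz : ∀ {k} (K : Fin (suc k) → Bool) → isLeastIn K fz ≡ true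
isLeastIn-fz {k} K = all-allFin⁻ {suc k} (λ y → not (y <ᶠ fz ∧ K y)) (λ _ → refl)

isLeastIn-fs : ∀ {k} (K : Fin (suc k) → Bool) w → isLeastIn K (fs w) ≡ not (K fz) ∧ isLeastIn (K ∘ fs) w
isLeastIn-fs {k} K w = trans (all-allFin-suc (λ y → not (y <ᶠ fs w ∧ K y)))
  (cong (λ bs → not (K fz) ∧ and bs) (map-cong (λ y → cong (λ b → not (b ∧ K (fs y))) (<ᶠ-fs y w)) (allFin k)))

parity : ∀ {k} → (Fin k → Bool) → Bool
parity {zero}  p = false
parity {suc k} p = p fz xor parity (p ∘ fs)

parity-cong : ∀ {k} {p q : Fin k → Bool} → (∀ i → p i ≡ q i) → parity p ≡ parity q
parity-cong {zero}  h = refl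
parity-cong {suc k} h = cong₂ _xor_ (h fz) (parity-cong (h ∘ fs))

parity-xor : ∀ {k} (p q : Fin k → Bool) → parity (λ i → p i xor q i) ≡ parity p xor parity q
parity-xor {zero}  p q = refl
parity-xor {suc k} p q = trans (cong ((p fz xor q fz) xor_) (parity-xor (p ∘ fs) (q ∘ fs)))
  (xor-interchange (p fz) (q fz) _ _)

parity-false : ∀ {k} (p : Fin k → Bool) → (∀ i → p i ≡ false) → parity p ≡ false
parity-false {zero}  p h = refl
parity-false {suc k} p h rewrite h fz = parity-false (p ∘ fs) (h ∘ fs)

parity-∧ : ∀ {k} (b : Bool) (p : Fin k → Bool) → parity (λ i → b ∧ p i) ≡ b ∧ parity p
parity-∧ {k} false p = parity-false {k} _ (λ i → refl)
parity-∧ true  p = refl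

parity-∧-const : ∀ {k} (p : Fin k → Bool) g → parity p ≡ true → parity (λ w → p w ∧ g) ≡ g
parity-∧-const p g odd = trans (parity-cong (λ w → ∧-comm (p w) g)) (trans (parity-∧ g p) (trans (cong (g ∧_) odd) (∧-identityʳ g)))

parity-point : ∀ {k} (p : Fin k → Bool) (a : Fin k) → (∀ i → i ≢ a → p i ≡ false) → parity p ≡ p a
parity-point {suc k} p fz off
  rewrite parity-false (p ∘ fs) (λ i → off (fs i) (λ ())) = xor-identityʳ (p fz)
parity-point {suc k} p (fs a) off
  rewrite off fz (λ ()) = parity-point (p ∘ fs) a (λ i i≢a → off (fs i) (i≢a ∘ suc-injective))

parity-least : ∀ {k} (K : Fin k → Bool) x → K x ≡ true → parity (λ w → K w ∧ isLeastIn K w) ≡ true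
parity-least {suc k} K x Kx =
  trans (cong₂ (λ a b → K fz ∧ a xor b) (isLeastIn-fz K) (parity-cong (λ w → cong (K (fs w) ∧_) (isLeastIn-fs K w))))
        (by-head (K fz) refl x Kx)
  where
  by-head : ∀ b → K fz ≡ b → ∀ x → K x ≡ true →
            b ∧ true xor parity (λ w → K (fs w) ∧ (not b ∧ isLeastIn (K ∘ fs) w)) ≡ true
  by-head true  _  _      _  = cong (true xor_) (parity-false _ (λ w → ∧-zeroʳ (K (fs w))))
  by-head false K₀ fz     Kx = ⊥-elim (false≢true (trans (sym K₀) Kx))
  by-head false K₀ (fs x) Kx = parity-least (K ∘ fs) x Kx

count-suc : ∀ {k} (p : Fin (suc k) → Bool) → count p ≡ (if p fz then suc (count (p ∘ fs)) else count (p ∘ fs))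
count-suc {k} p = cong (λ c → if p fz then suc c else c)
  (trans (cong (foldr (λ i c → if p i then suc c else c) 0) (sym (map-tabulate id fs)))
         (foldr-map (λ i c → if p i then suc c else c) fs 0 (allFin k)))

count-cong : ∀ {k} {p q : Fin k → Bool} → (∀ i → p i ≡ q i) → count p ≡ count q
count-cong {zero}      h = refl
count-cong {suc k} {p} {q} h
  rewrite count-suc p | count-suc q | h fz | count-cong {p = p ∘ fs} {q ∘ fs} (h ∘ fs) = refl

count-insert : ∀ {k} (p q : Fin k → Bool) a → p a ≡ false → q a ≡ true → (∀ i → i ≢ a → p i ≡ q i) →
  count q ≡ suc (count p)
count-insert {suc k} p q fz pa qa h
  rewrite count-suc p | count-suc q | pa | qa | count-cong {p = p ∘ fs} {q ∘ fs} (λ i → h (fs i) (λ ())) = refl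
count-insert {suc k} p q (fs a) pa qa h
  rewrite count-suc p | count-suc q | h fz (λ ())
        | count-insert (p ∘ fs) (q ∘ fs) a pa qa (λ i i≢a → h (fs i) (i≢a ∘ suc-injective)) with q fz
... | true  = refl
... | false = refl

count-none : ∀ {k} (p : Fin k → Bool) → (∀ i → p i ≡ false) → count p ≡ 0
count-none {zero}  p h = refl
count-none {suc k} p h rewrite count-suc p | h fz = count-none (p ∘ fs) (h ∘ fs)

count≡0⇒none : ∀ {k} (p : Fin k → Bool) → count p ≡ 0 → ∀ i → p i ≡ false
count≡0⇒none {suc k} p h i rewrite count-suc p with p fz in p₀ | i
... | false | fz   = p₀
... | false | fs j = count≡0⇒none (p ∘ fs) h j

count-all : ∀ {k} (p : Fin k → Bool) → (∀ i → p i ≡ true) → count p ≡ k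
count-all {zero}  p h = refl
count-all {suc k} p h rewrite count-suc p | h fz = cong suc (count-all (p ∘ fs) (h ∘ fs))

count-≤ : ∀ {k} (p : Fin k → Bool) → count p ≤ k
count-≤ {zero}  p = z≤n
count-≤ {suc k} p rewrite count-suc p with p fz
... | true  = s≤s (count-≤ (p ∘ fs))
... | false = ℕP.m≤n⇒m≤1+n (count-≤ (p ∘ fs))

vec-ext : ∀ {A : Set} {k} {xs ys : Vec A k} → (∀ i → lookup xs i ≡ lookup ys i) → xs ≡ ys
vec-ext {xs = xs} {ys} h = trans (sym (tabulate∘lookup xs)) (trans (tabulate-cong h) (tabulate∘lookup ys))

vec-diff : ∀ {k} (a b : Vec Bool k) → a ≢ b → ∃ λ w → lookup a w ≢ lookup b w
vec-diff a b a≢b with any? (λ w → ¬? (lookup a w ≟ᵇ lookup b w))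
... | yes found = found
... | no  none  = ⊥-elim (a≢b (vec-ext λ w → decidable-stable (lookup a w ≟ᵇ lookup b w) (λ ne → none (w , ne))))

_≡ᵛ_ : ∀ {k} → Vec Bool k → Vec Bool k → Bool
a ≡ᵛ b = ⌊ ≡-dec _≟ᵇ_ a b ⌋

≡ᵛ-refl : ∀ {k} (a : Vec Bool k) → (a ≡ᵛ a) ≡ true
≡ᵛ-refl a = ⌊⌋-yes (≡-dec _≟ᵇ_ a a) refl

≢⇒≡ᵛ-false : ∀ {k} {a b : Vec Bool k} → a ≢ b → (a ≡ᵛ b) ≡ false
≢⇒≡ᵛ-false {a = a} {b} = ⌊⌋-no (≡-dec _≟ᵇ_ a b)

_⊕_ : ∀ {k} → Vec Bool k → Vec Bool k → Vec Bool k
_⊕_ = V.zipWith _xor_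

lookup-⊕ : ∀ {k} (a b : Vec Bool k) w → lookup (a ⊕ b) w ≡ lookup a w xor lookup b w
lookup-⊕ a b w = lookup-zipWith _xor_ w a b

del add : ∀ {k} → Vec Bool k → Fin k → Vec Bool k
del t e = t [ e ]≔ false
add t e = t [ e ]≔ true

[]≔-restore : ∀ {A : Set} {k} (t : Vec A k) e x y → lookup t e ≡ y → (t [ e ]≔ x) [ e ]≔ y ≡ t
[]≔-restore t e x y h = trans ([]≔-idempotent t e) (trans (cong (t [ e ]≔_) (sym h)) ([]≔-lookup t e))

lookup-[]≔-other : ∀ {A : Set} {k} (t : Vec A k) {e i} x → e ≢ i → lookup (t [ e ]≔ x) i ≡ lookup t i
lookup-[]≔-other t x e≢i = lookup∘update′ (e≢i ∘ sym) t x

del-⊆ : ∀ {k} (s : Vec Bool k) e {e′} → lookup (del s e) e′ ≡ true → lookup s e′ ≡ true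
del-⊆ s e {e′} h with e ≟ᶠ e′
... | yes refl = ⊥-elim (false≢true (trans (sym (lookup∘update e s false)) h))
... | no  e≢e′ = trans (sym (lookup-[]≔-other s false e≢e′)) h

count-add : ∀ {k} (s : Vec Bool k) e → lookup s e ≡ false → count (lookup (add s e)) ≡ suc (count (lookup s))
count-add s e se = count-insert (lookup s) (lookup (add s e)) e se (lookup∘update e s true)
  (λ i i≢e → sym (lookup-[]≔-other s true (i≢e ∘ sym)))

nse-add : ∀ {k} (s : Vec Bool k) a e → lookup s a ≡ false → nse (add s a) e ≡ nse s e ℕ.+ ind (a <ᶠ e)
nse-add s a e sa with a <ᶠ e in a<e
... | true  = trans (count-insert (λ f → lookup s f ∧ (f <ᶠ e)) (λ f → lookup (add s a) f ∧ (f <ᶠ e)) a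
                       (cong (_∧ (a <ᶠ e)) sa) (cong₂ _∧_ (lookup∘update a s true) a<e) elsewhere)
                    (ℕP.+-comm 1 (nse s e))
  where
  elsewhere : ∀ i → i ≢ a → (lookup s i ∧ (i <ᶠ e)) ≡ (lookup (add s a) i ∧ (i <ᶠ e))
  elsewhere i i≢a = cong (_∧ (i <ᶠ e)) (sym (lookup-[]≔-other s true (i≢a ∘ sym)))
... | false = trans (count-cong unchanged) (sym (ℕP.+-identityʳ _))
  where
  unchanged : ∀ i → (lookup (add s a) i ∧ (i <ᶠ e)) ≡ (lookup s i ∧ (i <ᶠ e))
  unchanged i with a ≟ᶠ i
  ... | yes refl = trans (cong₂ _∧_ (lookup∘update a s true) a<e) (sym (cong (_∧ (a <ᶠ e)) sa))
  ... | no  a≢i  = cong (_∧ (i <ᶠ e)) (lookup-[]≔-other s true a≢i)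

module _ {k : ℕ} (f : Subset k → Subset k) (inflationary : ∀ R → R ⊆ f R) where

  private
    grows : ∀ R → Nonempty R → ∀ i → f (iter i f R) ≡ iter i f R ⊎ suc i ≤ ∣ iter i f R ∣
    grows R (x , x∈R) zero = inj₂ (ℕP.≤-trans (s≤s z≤n) (x∈p⇒∣p-x∣<∣p∣ x∈R))
    grows R ne (suc i) with grows R ne i
    ... | inj₁ fixed = inj₁ (cong f fixed)
    ... | inj₂ big with ≡-dec _≟ᵇ_ (f (iter i f R)) (iter i f R)
    ...   | yes fixed = inj₁ (cong f fixed)
    ...   | no  moved = inj₂ (ℕP.≤-trans (s≤s big) (p⊂q⇒∣p∣<∣q∣ (inflationary Rᵢ , new-point)))
      where
      Rᵢ : Subset k
      Rᵢ = iter i f R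
      new-point : ∃ λ x → x ∈ f Rᵢ × x ∉ Rᵢ
      new-point with w , differ ← vec-diff (f Rᵢ) Rᵢ moved = w , decide (lookup Rᵢ w) refl
        where
        decide : ∀ b → lookup Rᵢ w ≡ b → w ∈ f Rᵢ × w ∉ Rᵢ
        decide true  Rᵢw = ⊥-elim (differ (trans ([]=⇒lookup (inflationary Rᵢ (lookup⇒[]= w Rᵢ Rᵢw))) (sym Rᵢw)))
        decide false Rᵢw = lookup⇒[]= w (f Rᵢ) (¬-not (λ fRᵢw → differ (trans fRᵢw (sym Rᵢw))))
                         , λ w∈Rᵢ → false≢true (trans (sym Rᵢw) ([]=⇒lookup w∈Rᵢ))

  iter-fixed : ∀ R → Nonempty R → f (iter k f R) ≡ iter k f R
  iter-fixed R ne with grows R ne k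
  ... | inj₁ fixed = fixed
  ... | inj₂ big   = ⊥-elim (ℕP.<⇒≱ big (∣p∣≤n (iter k f R)))

-- Signs and finite sums

sign-+ : ∀ a b → sign (a ℕ.+ b) ≡ sign a * sign b
sign-+ zero    b = sym (ℚP.*-identityˡ _)
sign-+ (suc a) b = trans (cong -_ (sign-+ a b)) (ℚP.neg-distribˡ-* (sign a) (sign b))

sign-sq : ∀ a → sign a * sign a ≡ 1ℚ
sign-sq zero    = refl
sign-sq (suc a) = trans (solve 1 (λ x → (:- x) :* (:- x) := x :* x) refl (sign a)) (sign-sq a)

sign-anticommute : ∀ {k} (s : Vec Bool k) e e₀ → lookup s e ≡ true → lookup s e₀ ≡ false → e ≢ e₀ →
  sign (nse (del s e) e) * sign (nse (del s e) e₀) ≡ - (sign (nse s e₀) * sign (nse (add (del s e) e₀) e))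
sign-anticommute s e e₀ se se₀ e≢e₀ = begin
    sign a₁ * sign a₀
  ≡⟨ solve 2 (λ a b → a :* b := :- ((b :* a) :* (:- con 1ℚ))) refl (sign a₁) (sign a₀) ⟩
    - ((sign a₀ * sign a₁) * sign 1)
  ≡⟨ cong (λ i → - ((sign a₀ * sign a₁) * sign i)) (<ᶠ-exclusive e e₀ e≢e₀) ⟨
    - ((sign a₀ * sign a₁) * sign (i₁ ℕ.+ i₂))
  ≡⟨ cong (λ x → - ((sign a₀ * sign a₁) * x)) (sign-+ i₁ i₂) ⟩
    - ((sign a₀ * sign a₁) * (sign i₁ * sign i₂))
  ≡⟨ cong -_ (solve 4 (λ b a p q → (b :* a) :* (p :* q) := (b :* p) :* (a :* q)) refl (sign a₀) (sign a₁) (sign i₁) (sign i₂)) ⟩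
    - ((sign a₀ * sign i₁) * (sign a₁ * sign i₂))
  ≡⟨ cong₂ (λ x y → - (x * y)) (sign-+ a₀ i₁) (sign-+ a₁ i₂) ⟨
    - (sign (a₀ ℕ.+ i₁) * sign (a₁ ℕ.+ i₂))
  ≡⟨ cong₂ (λ x y → - (sign x * sign y)) nse-s nse-r+e₀ ⟨
    - (sign (nse s e₀) * sign (nse (add r e₀) e))
  ∎
  where
  open ≡-Reasoning
  r : Vec Bool _
  r = del s e
  a₁ a₀ i₁ i₂ : ℕ
  a₁ = nse r e
  a₀ = nse r e₀
  i₁ = ind (e <ᶠ e₀)
  i₂ = ind (e₀ <ᶠ e)
  nse-s : nse s e₀ ≡ a₀ ℕ.+ i₁
  nse-s = trans (cong (λ x → nse x e₀) (sym ([]≔-restore s e false true se))) (nse-add r e e₀ (lookup∘update e s false))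
  nse-r+e₀ : nse (add r e₀) e ≡ a₁ ℕ.+ i₂
  nse-r+e₀ = nse-add r e₀ e (trans (lookup-[]≔-other s false e≢e₀) se₀)

sgn : Bool → ℚ
sgn b = if b then - 1ℚ else 1ℚ

sgn-xor : ∀ a b → sgn (a xor b) ≡ sgn a * sgn b
sgn-xor true  true  = refl
sgn-xor true  false = refl
sgn-xor false true  = refl
sgn-xor false false = refl

sgn-sq : ∀ a → sgn a * sgn a ≡ 1ℚ
sgn-sq true  = refl
sgn-sq false = refl

sgn-not : ∀ a → sgn (not a) ≡ - sgn a
sgn-not true  = refl
sgn-not false = refl

sgn-fibre : ∀ x δ p → x * sgn p + x * sgn ((true ∧ δ) xor p) ≡ (if not δ then (x + x) * sgn p else 0ℚ)
sgn-fibre x false p = sym (ℚP.*-distribʳ-+ (sgn p) x x)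
sgn-fibre x true  p = trans (cong (λ y → x * sgn p + x * y) (sgn-not p))
  (solve 2 (λ x y → x :* y :+ x :* (:- y) := con 0ℚ) refl x (sgn p))

∑ : List X → (X → ℚ) → ℚ
∑ xs F = sumℚ (L.map F xs)

∑-cong : (xs : List X) {F G : X → ℚ} → (∀ x → F x ≡ G x) → ∑ xs F ≡ ∑ xs G
∑-cong []       eq = refl
∑-cong (x ∷ xs) eq = cong₂ _+_ (eq x) (∑-cong xs eq)

∑-0 : (xs : List X) → ∑ xs (λ _ → 0ℚ) ≡ 0ℚ
∑-0 []       = refl
∑-0 (x ∷ xs) = trans (ℚP.+-identityˡ _) (∑-0 xs)

∑-zero : (xs : List X) {F : X → ℚ} → (∀ x → F x ≡ 0ℚ) → ∑ xs F ≡ 0ℚ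
∑-zero xs eq = trans (∑-cong xs eq) (∑-0 xs)

∑-+ : (xs : List X) (F G : X → ℚ) → ∑ xs (λ x → F x + G x) ≡ ∑ xs F + ∑ xs G
∑-+ []       F G = refl
∑-+ (x ∷ xs) F G = trans (cong (F x + G x +_) (∑-+ xs F G))
  (solve 4 (λ a b c d → (a :+ b) :+ (c :+ d) := (a :+ c) :+ (b :+ d)) refl (F x) (G x) (∑ xs F) (∑ xs G))

∑-*ˡ : (xs : List X) (c : ℚ) (F : X → ℚ) → ∑ xs (λ x → c * F x) ≡ c * ∑ xs F
∑-*ˡ []       c F = sym (ℚP.*-zeroʳ c)
∑-*ˡ (x ∷ xs) c F = trans (cong (c * F x +_) (∑-*ˡ xs c F)) (sym (ℚP.*-distribˡ-+ c (F x) (∑ xs F)))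

∑-*ʳ : (xs : List X) (c : ℚ) (F : X → ℚ) → ∑ xs (λ x → F x * c) ≡ ∑ xs F * c
∑-*ʳ xs c F = trans (∑-cong xs (λ x → ℚP.*-comm (F x) c)) (trans (∑-*ˡ xs c F) (ℚP.*-comm c _))

∑-neg : (xs : List X) (F : X → ℚ) → ∑ xs (λ x → - F x) ≡ - ∑ xs F
∑-neg []       F = refl
∑-neg (x ∷ xs) F = trans (cong (- F x +_) (∑-neg xs F)) (sym (ℚP.neg-distrib-+ (F x) _))

∑-++ : (xs ys : List X) (F : X → ℚ) → ∑ (xs ++ ys) F ≡ ∑ xs F + ∑ ys F
∑-++ []       ys F = sym (ℚP.+-identityˡ _)
∑-++ (x ∷ xs) ys F = trans (cong (F x +_) (∑-++ xs ys F)) (sym (ℚP.+-assoc (F x) _ _))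

∑-map : (xs : List X) (f : X → Y) (F : Y → ℚ) → ∑ (L.map f xs) F ≡ ∑ xs (F ∘ f)
∑-map []       f F = refl
∑-map (x ∷ xs) f F = cong (F (f x) +_) (∑-map xs f F)

∑-concatMap : (xs : List X) (g : X → List Y) (F : Y → ℚ) →
  ∑ (concatMap g xs) F ≡ ∑ xs (λ x → ∑ (g x) F)
∑-concatMap []       g F = refl
∑-concatMap (x ∷ xs) g F = trans (∑-++ (g x) (concatMap g xs) F) (cong (∑ (g x) F +_) (∑-concatMap xs g F))

sumℚ-concatMap : (xs : List X) (g : X → List ℚ) → sumℚ (concatMap g xs) ≡ ∑ xs (λ x → sumℚ (g x))
sumℚ-concatMap xs g = trans (cong sumℚ (sym (Data.List.Properties.map-id (concatMap g xs))))
  (trans (∑-concatMap xs g id) (∑-cong xs (λ x → cong sumℚ (Data.List.Properties.map-id (g x)))))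
  where import Data.List.Properties

∑-swap : (xs : List X) (ys : List Y) (F : X → Y → ℚ) →
  ∑ xs (λ x → ∑ ys (F x)) ≡ ∑ ys (λ y → ∑ xs (λ x → F x y))
∑-swap []       ys F = sym (∑-0 ys)
∑-swap (x ∷ xs) ys F = trans (cong (∑ ys (F x) +_) (∑-swap xs ys F))
  (sym (∑-+ ys (F x) (λ y → ∑ xs (λ x → F x y))))

∑Fin : (m : ℕ) → (Fin m → ℚ) → ℚ
∑Fin m = ∑ (allFin m)

∑Fin-suc : (m : ℕ) (F : Fin (suc m) → ℚ) → ∑Fin (suc m) F ≡ F fz + ∑Fin m (F ∘ fs)
∑Fin-suc m F = cong (F fz +_) (trans (cong sumℚ (map-tabulate fs F)) (cong sumℚ (sym (map-tabulate id (F ∘ fs)))))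

∑Fin-point : (m : ℕ) (F : Fin m → ℚ) (a : Fin m) → (∀ e → e ≢ a → F e ≡ 0ℚ) → ∑Fin m F ≡ F a
∑Fin-point (suc m) F fz     off = trans (∑Fin-suc m F)
  (trans (cong (F fz +_) (∑-zero (allFin m) (λ e → off (fs e) (λ ())))) (ℚP.+-identityʳ _))
∑Fin-point (suc m) F (fs a) off = trans (∑Fin-suc m F)
  (trans (cong₂ _+_ (off fz (λ ())) (∑Fin-point m (F ∘ fs) a (λ e e≢a → off (fs e) (e≢a ∘ suc-injective))))
    (ℚP.+-identityˡ _))

∑Sub : (k : ℕ) → (Vec Bool k → ℚ) → ℚ
∑Sub k = ∑ (allSub k)

∑Sub-suc : (k : ℕ) (F : Vec Bool (suc k) → ℚ) → ∑Sub (suc k) F ≡ ∑Sub k (λ v → F (false ∷ v) + F (true ∷ v))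
∑Sub-suc k F = trans (∑-concatMap (allSub k) (λ v → (false ∷ v) ∷ (true ∷ v) ∷ []) F)
  (∑-cong (allSub k) (λ v → cong (F (false ∷ v) +_) (ℚP.+-identityʳ _)))

∑Sub-point : (k : ℕ) (F : Vec Bool k → ℚ) (a : Vec Bool k) → (∀ v → v ≢ a → F v ≡ 0ℚ) → ∑Sub k F ≡ F a
∑Sub-point zero    F []      off = ℚP.+-identityʳ _
∑Sub-point (suc k) F (b ∷ a) off = trans (∑Sub-suc k F) (trans (∑Sub-point k _ a off-tail) (on b off))
  where
  off-tail : ∀ v → v ≢ a → F (false ∷ v) + F (true ∷ v) ≡ 0ℚ
  off-tail v v≢a = trans (cong₂ _+_ (off _ (v≢a ∘ cong V.tail)) (off _ (v≢a ∘ cong V.tail))) (ℚP.+-identityˡ _)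
  on : ∀ b → (∀ v → v ≢ b ∷ a → F v ≡ 0ℚ) → F (false ∷ a) + F (true ∷ a) ≡ F (b ∷ a)
  on false off = trans (cong (F (false ∷ a) +_) (off _ (λ ()))) (ℚP.+-identityʳ _)
  on true  off = trans (cong (_+ F (true ∷ a)) (off _ (λ ()))) (ℚP.+-identityˡ _)

∑Sub-translate : (k : ℕ) (F : Vec Bool k → ℚ) (d : Vec Bool k) → ∑Sub k (λ c → F (c ⊕ d)) ≡ ∑Sub k F
∑Sub-translate zero    F []       = refl
∑Sub-translate (suc k) F (d₀ ∷ d) = begin
    ∑Sub (suc k) (λ c → F (c ⊕ (d₀ ∷ d)))
  ≡⟨ ∑Sub-suc k _ ⟩
    ∑Sub k (λ v → F ((false xor d₀) ∷ (v ⊕ d)) + F ((true xor d₀) ∷ (v ⊕ d)))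
  ≡⟨ ∑Sub-translate k (λ v → F ((false xor d₀) ∷ v) + F ((true xor d₀) ∷ v)) d ⟩
    ∑Sub k (λ v → F ((false xor d₀) ∷ v) + F ((true xor d₀) ∷ v))
  ≡⟨ ∑-cong (allSub k) (swap d₀) ⟩
    ∑Sub k (λ v → F (false ∷ v) + F (true ∷ v))
  ≡⟨ ∑Sub-suc k F ⟨
    ∑Sub (suc k) F
  ∎
  where
  open ≡-Reasoning
  swap : ∀ d₀ v → F ((false xor d₀) ∷ v) + F ((true xor d₀) ∷ v) ≡ F (false ∷ v) + F (true ∷ v)
  swap false v = refl
  swap true  v = ℚP.+-comm (F (true ∷ v)) (F (false ∷ v))

∑Sub-≥-term : (k : ℕ) (F : Vec Bool k → ℚ) → (∀ x → 0ℚ ℚ.≤ F x) → ∀ a → F a ℚ.≤ ∑Sub k F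
∑Sub-≥-term zero    F F≥0 [] = ℚP.≤-reflexive (sym (ℚP.+-identityʳ (F [])))
∑Sub-≥-term (suc k) F F≥0 (b ∷ a) = subst (F (b ∷ a) ℚ.≤_) (sym (∑Sub-suc k F))
  (ℚP.≤-trans (≤-pair b) (∑Sub-≥-term k _ (λ x → ℚP.+-mono-≤ (F≥0 _) (F≥0 _)) a))
  where
  ≤-pair : ∀ b → F (b ∷ a) ℚ.≤ F (false ∷ a) + F (true ∷ a)
  ≤-pair false = subst (ℚ._≤ F (false ∷ a) + F (true ∷ a)) (ℚP.+-identityʳ _) (ℚP.+-monoʳ-≤ (F (false ∷ a)) (F≥0 (true ∷ a)))
  ≤-pair true  = subst (ℚ._≤ F (false ∷ a) + F (true ∷ a)) (ℚP.+-identityˡ _) (ℚP.+-monoˡ-≤ (F (true ∷ a)) (F≥0 (false ∷ a)))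

∑-allPre : ∀ n m (F : PreState n m → ℚ) → ∑ (allPre n m) F ≡ ∑Sub m (λ s → ∑Sub n (λ ℓ → F (s , ℓ)))
∑-allPre n m F = trans (∑-concatMap (allSub m) (λ s → L.map (s ,_) (allSub n)) F)
  (∑-cong (allSub m) (λ s → ∑-map (allSub n) (s ,_) F))

if-0 : ∀ b {x : ℚ} → x ≡ 0ℚ → (if b then x else 0ℚ) ≡ 0ℚ
if-0 true  x≡0 = x≡0
if-0 false _   = refl

*-if : ∀ b (y x : ℚ) → y * (if b then x else 0ℚ) ≡ (if b then y * x else 0ℚ)
*-if true  y x = refl
*-if false y x = ℚP.*-zeroʳ y

if-* : ∀ b (x y : ℚ) → (if b then x else 0ℚ) * y ≡ (if b then x * y else 0ℚ)
if-* true  x y = refl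
if-* false x y = ℚP.*-zeroˡ y

if-congʳ : ∀ b {x y : ℚ} → (b ≡ true → x ≡ y) → (if b then x else 0ℚ) ≡ (if b then y else 0ℚ)
if-congʳ true  x≡y = x≡y refl
if-congʳ false _   = refl

sumℚ-if : ∀ b (h : X → ℚ) (xs : List X) → sumℚ (if b then L.map h xs else []) ≡ ∑ xs (λ x → if b then h x else 0ℚ)
sumℚ-if true  h xs = refl
sumℚ-if false h xs = sym (∑-0 xs)

≡-neg⇒0 : ∀ x → x ≡ - x → x ≡ 0ℚ
≡-neg⇒0 x x≡-x = begin
    x                 ≡⟨ solve 1 (λ x → x := (x :+ x) :* con ℚ.½) refl x ⟩
    (x + x) * ℚ.½     ≡⟨ cong (λ y → (x + y) * ℚ.½) x≡-x ⟩
    (x + - x) * ℚ.½   ≡⟨ solve 1 (λ x → (x :+ :- x) :* con ℚ.½ := con 0ℚ) refl x ⟩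
    0ℚ                ∎
  where open ≡-Reasoning

solve-second : ∀ p x y → p * p ≡ 1ℚ → x + p * y ≡ 0ℚ → y ≡ - (p * x)
solve-second p x y p²≡1 x+py≡0 = begin
    y
  ≡⟨ solve 3 (λ p x y → y := p :* ((x :+ p :* y) :+ :- x) :+ (con 1ℚ :+ :- (p :* p)) :* y) refl p x y ⟩
    p * ((x + p * y) + - x) + (1ℚ + - (p * p)) * y
  ≡⟨ cong₂ (λ u v → p * (u + - x) + (1ℚ + - v) * y) x+py≡0 p²≡1 ⟩
    p * (0ℚ + - x) + (1ℚ + - 1ℚ) * y
  ≡⟨ solve 3 (λ p x y → p :* (con 0ℚ :+ :- x) :+ (con 1ℚ :+ :- con 1ℚ) :* y := :- (p :* x)) refl p x y ⟩
    - (p * x)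
  ∎
  where open ≡-Reasoning

both-zero : ∀ p x y → p * p ≡ 1ℚ → x + p * y ≡ 0ℚ → x + (p * - 1ℚ) * y ≡ 0ℚ → x ≡ 0ℚ × y ≡ 0ℚ
both-zero p x y p²≡1 plus minus = x≡0 , trans (solve-second p x y p²≡1 plus) (trans (cong (λ z → - (p * z)) x≡0) (cong -_ (ℚP.*-zeroʳ p)))
  where
  open ≡-Reasoning
  x≡0 : x ≡ 0ℚ
  x≡0 = begin
      x
    ≡⟨ solve 3 (λ x p y → x := ((x :+ p :* y) :+ (x :+ (p :* (:- con 1ℚ)) :* y)) :* con ℚ.½) refl x p y ⟩
      ((x + p * y) + (x + (p * - 1ℚ) * y)) * ℚ.½
    ≡⟨ cong₂ (λ u v → (u + v) * ℚ.½) plus minus ⟩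
      0ℚ
    ∎

minus-plus : ∀ x y → (x ℤ.- y) ℤ.+ y ≡ x
minus-plus x y = trans (ℤP.+-assoc x (ℤ.- y) y) (trans (cong (ℤ._+_ x) (ℤP.+-inverseˡ y)) (ℤP.+-identityʳ x))

plus-minus : ∀ x y → (x ℤ.+ y) ℤ.- y ≡ x
plus-minus x y = trans (ℤP.+-assoc x y (ℤ.- y)) (trans (cong (ℤ._+_ x) (ℤP.+-inverseʳ y)) (ℤP.+-identityʳ x))

≤-minus⇒ : ∀ a n k → ℤ.+ a ℤ.≤ ℤ.+ n ℤ.- ℤ.+ k → a ℕ.+ k ≤ n
≤-minus⇒ a n k h = ℤ.drop‿+≤+ (subst (ℤ.+ (a ℕ.+ k) ℤ.≤_) (minus-plus (ℤ.+ n) (ℤ.+ k)) (ℤP.+-monoˡ-≤ (ℤ.+ k) h))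

⇒≤-minus : ∀ a n k → a ℕ.+ k ≤ n → ℤ.+ a ℤ.≤ ℤ.+ n ℤ.- ℤ.+ k
⇒≤-minus a n k h = subst (ℤ._≤ ℤ.+ n ℤ.- ℤ.+ k) (plus-minus (ℤ.+ a) (ℤ.+ k)) (ℤP.+-monoˡ-≤ (ℤ.- ℤ.+ k) (ℤ.+≤+ h))

module _ {n m : ℕ} (Γ : Graph n m) where

  -- Connected components

  data Edge (s : Sub m) (a b : Fin n) : Set where
    edge : (e : Fin m) → lookup s e ≡ true →
           (src Γ e ≡ a × tgt Γ e ≡ b) ⊎ (src Γ e ≡ b × tgt Γ e ≡ a) → Edge s a b

  Path : Sub m → Fin n → Fin n → Set
  Path s = Star (Edge s)

  edge-of : ∀ {s} e → lookup s e ≡ true → Edge s (src Γ e) (tgt Γ e)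
  edge-of e se = edge e se (inj₁ (refl , refl))

  edge-sym : ∀ {s a b} → Edge s a b → Edge s b a
  edge-sym (edge e se (inj₁ p)) = edge e se (inj₂ p)
  edge-sym (edge e se (inj₂ p)) = edge e se (inj₁ p)

  path-sym : ∀ {s a b} → Path s a b → Path s b a
  path-sym ε       = ε
  path-sym (x ◅ p) = path-sym p ◅◅ (edge-sym x ◅ ε)

  path-mono : ∀ {s t} → (∀ e → lookup s e ≡ true → lookup t e ≡ true) → ∀ {a b} → Path s a b → Path t a b
  path-mono s⊆t ε                   = ε
  path-mono s⊆t (edge e se ends ◅ p) = edge e (s⊆t e se) ends ◅ path-mono s⊆t p

  Invariant : Sub m → (Fin n → Bool) → Set
  Invariant s x = ∀ e → lookup s e ≡ true → x (src Γ e) ≡ x (tgt Γ e)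

  path-invariant : ∀ {s} x → Invariant s x → ∀ {a b} → Path s a b → x a ≡ x b
  path-invariant x inv ε                                     = refl
  path-invariant x inv (edge e se (inj₁ (refl , refl)) ◅ p) = trans (inv e se) (path-invariant x inv p)
  path-invariant x inv (edge e se (inj₂ (refl , refl)) ◅ p) = trans (sym (inv e se)) (path-invariant x inv p)

  private
    stepP : Sub m → Sub n → Fin n → Fin m → Bool
    stepP s R w e = lookup s e ∧
      ((lookup R (src Γ e) ∧ ⌊ tgt Γ e ≟ᶠ w ⌋) ∨ (lookup R (tgt Γ e) ∧ ⌊ src Γ e ≟ᶠ w ⌋))

    lookup-step : ∀ s R w → lookup (step Γ s R) w ≡ lookup R w ∨ any (stepP s R w) (allFin m)
    lookup-step s R w = lookup∘tabulate _ w

    step-⊇ : ∀ s R w → lookup R w ≡ true → lookup (step Γ s R) w ≡ true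
    step-⊇ s R w Rw rewrite lookup-step s R w | Rw = refl

    point : Fin n → Sub n
    point a = tabulate λ w → ⌊ a ≟ᶠ w ⌋

    point-self : ∀ a → lookup (point a) a ≡ true
    point-self a = trans (lookup∘tabulate _ a) (⌊⌋-yes (a ≟ᶠ a) refl)

    Reached : Sub m → Fin n → Sub n → Set
    Reached s a R = ∀ w → lookup R w ≡ true → Path s a w

    point-reached : ∀ s a → Reached s a (point a)
    point-reached s a w h with refl ← ⌊⌋-true⇒ (a ≟ᶠ w) (trans (sym (lookup∘tabulate _ w)) h) = ε

    step-reached : ∀ s a R → Reached s a R → Reached s a (step Γ s R)
    step-reached s a R reached w h with ∨-true⇒ {lookup R w} (trans (sym (lookup-step s R w)) h)
    ... | inj₁ Rw = reached w Rw
    ... | inj₂ hit with e , se∧ ← any-allFin⁺ (stepP s R w) hit with ∧-true⇒ {lookup s e} se∧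
    ...   | se , ends with ∨-true⇒ ends
    ...     | inj₁ fwd with Rsrc , t≡w ← ∧-true⇒ fwd =
              subst (Path s a) (⌊⌋-true⇒ (tgt Γ e ≟ᶠ w) t≡w) (reached _ Rsrc ◅◅ (edge-of e se ◅ ε))
    ...     | inj₂ bwd with Rtgt , s≡w ← ∧-true⇒ bwd =
              subst (Path s a) (⌊⌋-true⇒ (src Γ e ≟ᶠ w) s≡w) (reached _ Rtgt ◅◅ (edge-sym (edge-of e se) ◅ ε))

    fixed⇒invariant : ∀ s R → step Γ s R ≡ R → Invariant s (lookup R)
    fixed⇒invariant s R fixed e se = bool-ext forward backward
      where
      enters : ∀ w → any (stepP s R w) (allFin m) ≡ true → lookup R w ≡ true
      enters w hit = trans (cong (λ X → lookup X w) (sym fixed))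
                           (trans (lookup-step s R w) (trans (cong (lookup R w ∨_) hit) (∨-zeroʳ (lookup R w))))
      hits-tgt : lookup R (src Γ e) ≡ true → stepP s R (tgt Γ e) e ≡ true
      hits-tgt Rsrc rewrite se | Rsrc | ⌊⌋-yes (tgt Γ e ≟ᶠ tgt Γ e) refl = refl
      hits-src : lookup R (tgt Γ e) ≡ true → stepP s R (src Γ e) e ≡ true
      hits-src Rtgt rewrite se | Rtgt | ⌊⌋-yes (src Γ e ≟ᶠ src Γ e) refl = ∨-zeroʳ _
      forward : lookup R (src Γ e) ≡ true → lookup R (tgt Γ e) ≡ true
      forward Rsrc = enters (tgt Γ e) (any-allFin⁻ (stepP s R (tgt Γ e)) e (hits-tgt Rsrc))
      backward : lookup R (tgt Γ e) ≡ true → lookup R (src Γ e) ≡ true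
      backward Rtgt = enters (src Γ e) (any-allFin⁻ (stepP s R (src Γ e)) e (hits-src Rtgt))

  comp-sound : ∀ s a w → lookup (comp Γ s a) w ≡ true → Path s a w
  comp-sound s a = go n
    where
    go : ∀ i → Reached s a (iter i (step Γ s) (point a))
    go zero    = point-reached s a
    go (suc i) = step-reached s a (iter i (step Γ s) (point a)) (go i)

  comp-self : ∀ s a → lookup (comp Γ s a) a ≡ true
  comp-self s a = go n
    where
    go : ∀ i → lookup (iter i (step Γ s) (point a)) a ≡ true
    go zero    = point-self a
    go (suc i) = step-⊇ s (iter i (step Γ s) (point a)) a (go i)

  comp-invariant : ∀ s a → Invariant s (lookup (comp Γ s a))
  comp-invariant s a = fixed⇒invariant s (comp Γ s a)
    (iter-fixed (step Γ s) (λ R {w} w∈R → lookup⇒[]= w (step Γ s R) (step-⊇ s R w ([]=⇒lookup w∈R))) (point a)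
                (a , lookup⇒[]= a (point a) (point-self a)))

  comp-complete : ∀ s a w → Path s a w → lookup (comp Γ s a) w ≡ true
  comp-complete s a w p = trans (sym (path-invariant (lookup (comp Γ s a)) (comp-invariant s a) p)) (comp-self s a)

  comp-≡ : ∀ s a w → Path s a w → comp Γ s a ≡ comp Γ s w
  comp-≡ s a w p = vec-ext λ x → bool-ext
    (λ h → comp-complete s w x (path-sym p ◅◅ comp-sound s a x h))
    (λ h → comp-complete s a x (p ◅◅ comp-sound s w x h))

  isRep-in-comp : ∀ s a w → lookup (comp Γ s a) w ≡ true → isRep Γ s w ≡ isLeastIn (lookup (comp Γ s a)) w
  isRep-in-comp s a w h = cong (λ C → isLeastIn (lookup C) w) (sym (comp-≡ s a w (comp-sound s a w h)))

  parity-reps : ∀ s a → parity (λ w → lookup (comp Γ s a) w ∧ isRep Γ s w) ≡ true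
  parity-reps s a = trans (parity-cong on-comp) (parity-least (lookup (comp Γ s a)) a (comp-self s a))
    where
    on-comp : ∀ w → lookup (comp Γ s a) w ∧ isRep Γ s w ≡ lookup (comp Γ s a) w ∧ isLeastIn (lookup (comp Γ s a)) w
    on-comp w with lookup (comp Γ s a) w in h
    ... | false = refl
    ... | true  = isRep-in-comp s a w h

  isValid : Sub m → Sub n → Bool
  isValid s ℓ = validᵇ Γ (s , ℓ)

  isValid⇒invariant : ∀ s ℓ → isValid s ℓ ≡ true → Invariant s (lookup ℓ)
  isValid⇒invariant s ℓ h e se = ⌊⌋-true⇒ (_ ≟ᵇ _) (edge-ok (all-allFin⁺ _ h e))
    where
    edge-ok : not (lookup s e) ∨ (lookup ℓ (src Γ e) ≡ᵇ lookup ℓ (tgt Γ e)) ≡ true →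
              (lookup ℓ (src Γ e) ≡ᵇ lookup ℓ (tgt Γ e)) ≡ true
    edge-ok ok rewrite se = ok

  invariant⇒isValid : ∀ s ℓ → Invariant s (lookup ℓ) → isValid s ℓ ≡ true
  invariant⇒isValid s ℓ inv = all-allFin⁻ _ edge-ok
    where
    edge-ok : ∀ e → not (lookup s e) ∨ (lookup ℓ (src Γ e) ≡ᵇ lookup ℓ (tgt Γ e)) ≡ true
    edge-ok e with lookup s e in se
    ... | false = refl
    ... | true  = ⌊⌋-yes (_ ≟ᵇ _) (inv e se)

  isValid-⊕ : ∀ s c d → isValid s d ≡ true → isValid s (c ⊕ d) ≡ isValid s c
  isValid-⊕ s c d valid-d = bool-ext
    (λ h → invariant⇒isValid s c (λ e se → xor-cancelʳ (lookup d (src Γ e))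
      (begin
        lookup c (src Γ e) xor lookup d (src Γ e)  ≡⟨ lookup-⊕ c d _ ⟨
        lookup (c ⊕ d) (src Γ e)                   ≡⟨ isValid⇒invariant s (c ⊕ d) h e se ⟩
        lookup (c ⊕ d) (tgt Γ e)                   ≡⟨ lookup-⊕ c d _ ⟩
        lookup c (tgt Γ e) xor lookup d (tgt Γ e)  ≡⟨ cong (lookup c (tgt Γ e) xor_) (isValid⇒invariant s d valid-d e se) ⟨
        lookup c (tgt Γ e) xor lookup d (src Γ e)  ∎)))
    (λ h → invariant⇒isValid s (c ⊕ d) (λ e se → begin
        lookup (c ⊕ d) (src Γ e)                   ≡⟨ lookup-⊕ c d _ ⟩
        lookup c (src Γ e) xor lookup d (src Γ e)  ≡⟨ cong₂ _xor_ (isValid⇒invariant s c h e se) (isValid⇒invariant s d valid-d e se) ⟩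
        lookup c (tgt Γ e) xor lookup d (tgt Γ e)  ≡⟨ lookup-⊕ c d _ ⟨
        lookup (c ⊕ d) (tgt Γ e)                   ∎))
    where open ≡-Reasoning

  isValid-comp : ∀ s a → isValid s (comp Γ s a) ≡ true
  isValid-comp s a = invariant⇒isValid s (comp Γ s a) (comp-invariant s a)

  isValid-0 : ∀ s → isValid s (replicate n false) ≡ true
  isValid-0 s = invariant⇒isValid s (replicate n false) (λ e _ → trans (lookup-replicate (src Γ e) false) (sym (lookup-replicate (tgt Γ e) false)))

  -- The differential as a sum over deleted edges

  relabel : Sub m → Sub n → Fin m → Sub n
  relabel s ℓ e = proj₂ (addEdge Γ (s , ℓ) e)

  D-term : Cochain n m → Sub m → Sub n → Fin m → ℚ
  D-term f t ℓ′ e = if lookup t e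
    then sign (nse (del t e) e) *
         ∑Sub n (λ ℓ → if isValid (del t e) ℓ ∧ (relabel (del t e) ℓ e ≡ᵛ ℓ′) then f (del t e , ℓ) else 0ℚ)
    else 0ℚ

  private
    D-summand : Cochain n m → Sub m → Sub n → PreState n m → Fin m → ℚ
    D-summand f t ℓ′ S e = if not (lookup (proj₁ S) e) ∧ (proj₁ (addEdge Γ S e) ≡ᵛ t) ∧ (proj₂ (addEdge Γ S e) ≡ᵛ ℓ′)
                           then f S * sign (nse (proj₁ S) e) else 0ℚ

    D-summand-off : ∀ f t ℓ′ e s ℓ → s ≢ del t e → (if isValid s ℓ then D-summand f t ℓ′ (s , ℓ) e else 0ℚ) ≡ 0ℚ
    D-summand-off f t ℓ′ e s ℓ s≢ with isValid s ℓ | lookup s e in se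
    ... | false | _     = refl
    ... | true  | true  = refl
    ... | true  | false rewrite ≢⇒≡ᵛ-false {a = add s e} {t}
          (λ s+e≡t → s≢ (trans (sym ([]≔-restore s e true false se)) (cong (λ X → del X e) s+e≡t))) = refl

    D-summand-on : ∀ f t ℓ′ e → ∑Sub n (λ ℓ → if isValid (del t e) ℓ then D-summand f t ℓ′ (del t e , ℓ) e else 0ℚ)
                              ≡ D-term f t ℓ′ e
    D-summand-on f t ℓ′ e with lookup t e in te
    ... | false = ∑-zero (allSub n) λ ℓ → if-0 (isValid (del t e) ℓ) (not-t ℓ)
      where
      not-t : ∀ ℓ → D-summand f t ℓ′ (del t e , ℓ) e ≡ 0ℚ
      not-t ℓ rewrite lookup∘update e t false | ≢⇒≡ᵛ-false {a = add (del t e) e} {t}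
        (λ eq → false≢true (trans (sym te) (trans (cong (λ X → lookup X e) (sym eq)) (lookup∘update e (del t e) true)))) = refl
    ... | true = trans (∑-cong (allSub n) at-t) (∑-*ˡ (allSub n) (sign (nse (del t e) e)) _)
      where
      at-t : ∀ ℓ → (if isValid (del t e) ℓ then D-summand f t ℓ′ (del t e , ℓ) e else 0ℚ) ≡
                   sign (nse (del t e) e) * (if isValid (del t e) ℓ ∧ (relabel (del t e) ℓ e ≡ᵛ ℓ′) then f (del t e , ℓ) else 0ℚ)
      at-t ℓ rewrite lookup∘update e t false | []≔-restore t e false true te | ≡ᵛ-refl t
        with isValid (del t e) ℓ | relabel (del t e) ℓ e ≡ᵛ ℓ′
      ... | true  | true  = ℚP.*-comm (f (del t e , ℓ)) (sign (nse (del t e) e))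
      ... | true  | false = sym (ℚP.*-zeroʳ (sign (nse (del t e) e)))
      ... | false | _     = sym (ℚP.*-zeroʳ (sign (nse (del t e) e)))

  D-expand : ∀ f t ℓ′ → D Γ f (t , ℓ′) ≡ ∑Fin m (D-term f t ℓ′)
  D-expand f t ℓ′ = begin
      D Γ f (t , ℓ′)
    ≡⟨ sumℚ-concatMap (allPre n m) _ ⟩
      ∑ (allPre n m) (λ S → sumℚ (if validᵇ Γ S then L.map (Q S) (allFin m) else []))
    ≡⟨ ∑-allPre n m _ ⟩
      ∑Sub m (λ s → ∑Sub n (λ ℓ → sumℚ (if isValid s ℓ then L.map (Q (s , ℓ)) (allFin m) else [])))
    ≡⟨ ∑-cong (allSub m) (λ s → ∑-cong (allSub n) (λ ℓ → sumℚ-if (isValid s ℓ) (Q (s , ℓ)) (allFin m))) ⟩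
      ∑Sub m (λ s → ∑Sub n (λ ℓ → ∑Fin m (λ e → if isValid s ℓ then Q (s , ℓ) e else 0ℚ)))
    ≡⟨ ∑-cong (allSub m) (λ s → ∑-swap (allSub n) (allFin m) _) ⟩
      ∑Sub m (λ s → ∑Fin m (λ e → ∑Sub n (λ ℓ → if isValid s ℓ then Q (s , ℓ) e else 0ℚ)))
    ≡⟨ ∑-swap (allSub m) (allFin m) _ ⟩
      ∑Fin m (λ e → ∑Sub m (λ s → ∑Sub n (λ ℓ → if isValid s ℓ then Q (s , ℓ) e else 0ℚ)))
    ≡⟨ ∑-cong (allFin m) (λ e → ∑Sub-point m _ (del t e) (λ s s≢ → ∑-zero (allSub n) (λ ℓ → D-summand-off f t ℓ′ e s ℓ s≢))) ⟩
      ∑Fin m (λ e → ∑Sub n (λ ℓ → if isValid (del t e) ℓ then Q (del t e , ℓ) e else 0ℚ))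
    ≡⟨ ∑-cong (allFin m) (D-summand-on f t ℓ′) ⟩
      ∑Fin m (D-term f t ℓ′)
    ∎
    where
    open ≡-Reasoning
    Q : PreState n m → Fin m → ℚ
    Q = D-summand f t ℓ′

  D-cong : ∀ {f f′} → f ≈ f′ → D Γ f ≈ D Γ f′
  D-cong {f} {f′} f≈f′ (t , ℓ′) = trans (D-expand f t ℓ′) (trans (∑-cong (allFin m) same-term) (sym (D-expand f′ t ℓ′)))
    where
    same-term : ∀ e → D-term f t ℓ′ e ≡ D-term f′ t ℓ′ e
    same-term e = cong (λ F → if lookup t e then sign (nse (del t e) e) * F else 0ℚ) (∑-cong (allSub n) λ ℓ →
      cong (λ x → if isValid (del t e) ℓ ∧ (relabel (del t e) ℓ e ≡ᵛ ℓ′) then x else 0ℚ) (f≈f′ (del t e , ℓ)))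

  -- Characters

  -- The number of valid labellings of s, 2^(number of components); the transform squares to M s.
  M : Sub m → ℚ
  M s = ∑Sub n (λ c → if isValid s c then 1ℚ else 0ℚ)

  M-positive : ∀ s → 0ℚ ℚ.< M s
  M-positive s = ℚP.<-≤-trans (ℚP.positive⁻¹ _) (subst (ℚ._≤ M s) (cong (λ b → if b then 1ℚ else 0ℚ) (isValid-0 s))
    (∑Sub-≥-term n _ (λ c → indicator-≥0 (isValid s c)) (replicate n false)))
    where
    indicator-≥0 : ∀ b → 0ℚ ℚ.≤ (if b then 1ℚ else 0ℚ)
    indicator-≥0 true  = ℚP.nonNegative⁻¹ _
    indicator-≥0 false = ℚP.≤-refl

  M-nonZero : ∀ s → ℚ.NonZero (M s)
  M-nonZero s = ℚ.>-nonZero (M-positive s)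

  M⁻¹ : Sub m → ℚ
  M⁻¹ s = ℚ.1/_ (M s) {{M-nonZero s}}

  M⁻¹*M : ∀ s → M⁻¹ s * M s ≡ 1ℚ
  M⁻¹*M s = ℚP.*-inverseˡ (M s) {{M-nonZero s}}

  M⁻¹-cancel : ∀ s x → M⁻¹ s * (M s * x) ≡ x
  M⁻¹-cancel s x = trans (sym (ℚP.*-assoc (M⁻¹ s) (M s) x)) (trans (cong (_* x) (M⁻¹*M s)) (ℚP.*-identityˡ x))

  M⁻¹-unique : ∀ s x → x * M s ≡ 1ℚ → x ≡ M⁻¹ s
  M⁻¹-unique s x x*M≡1 = begin
    x                     ≡⟨ ℚP.*-identityʳ x ⟨
    x * 1ℚ                ≡⟨ cong (x *_) (trans (ℚP.*-comm (M s) (M⁻¹ s)) (M⁻¹*M s)) ⟨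
    x * (M s * M⁻¹ s)     ≡⟨ ℚP.*-assoc x (M s) (M⁻¹ s) ⟨
    (x * M s) * M⁻¹ s     ≡⟨ cong (_* M⁻¹ s) x*M≡1 ⟩
    1ℚ * M⁻¹ s            ≡⟨ ℚP.*-identityˡ (M⁻¹ s) ⟩
    M⁻¹ s                 ∎
    where open ≡-Reasoning

  M⁻¹-cong : ∀ {s t} → M s ≡ M t → M⁻¹ s ≡ M⁻¹ t
  M⁻¹-cong {s} {t} Ms≡Mt = M⁻¹-unique t (M⁻¹ s) (trans (cong (M⁻¹ s *_) (sym Ms≡Mt)) (M⁻¹*M s))

  M⁻¹-half : ∀ {s t} → M s ≡ M t + M t → M⁻¹ s + M⁻¹ s ≡ M⁻¹ t
  M⁻¹-half {s} {t} Ms≡2Mt = M⁻¹-unique t (M⁻¹ s + M⁻¹ s) (begin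
    (M⁻¹ s + M⁻¹ s) * M t  ≡⟨ solve 2 (λ x y → (x :+ x) :* y := x :* (y :+ y)) refl (M⁻¹ s) (M t) ⟩
    M⁻¹ s * (M t + M t)    ≡⟨ cong (M⁻¹ s *_) Ms≡2Mt ⟨
    M⁻¹ s * M s            ≡⟨ M⁻¹*M s ⟩
    1ℚ                     ∎)
    where open ≡-Reasoning

  -- χ s a c = (−1)^(number of components of s labelled x by both a and c), the matrix of the change
  -- of basis 1 ↦ e₊ + e₋, x ↦ e₊ − e₋ on each component; components are counted at their least vertex.
  pairing : Sub m → Sub n → Sub n → Bool
  pairing s a c = parity (λ w → isRep Γ s w ∧ (lookup a w ∧ lookup c w))

  χ : Sub m → Sub n → Sub n → ℚ
  χ s a c = sgn (pairing s a c)

  χ-sym : ∀ s a c → χ s a c ≡ χ s c a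
  χ-sym s a c = cong sgn (parity-cong λ w → cong (isRep Γ s w ∧_) (∧-comm (lookup a w) (lookup c w)))

  χ-⊕ : ∀ s a b c → χ s a c * χ s b c ≡ χ s (a ⊕ b) c
  χ-⊕ s a b c = trans (sym (sgn-xor (pairing s a c) (pairing s b c)))
    (cong sgn (trans (sym (parity-xor {n} (λ w → isRep Γ s w ∧ (lookup a w ∧ lookup c w))
                                          (λ w → isRep Γ s w ∧ (lookup b w ∧ lookup c w))))
                     (parity-cong pointwise)))
    where
    pointwise : ∀ w → (isRep Γ s w ∧ (lookup a w ∧ lookup c w)) xor (isRep Γ s w ∧ (lookup b w ∧ lookup c w))
                    ≡ isRep Γ s w ∧ (lookup (a ⊕ b) w ∧ lookup c w)
    pointwise w rewrite lookup-⊕ a b w = distrib (isRep Γ s w) (lookup a w) (lookup b w) (lookup c w)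
      where
      distrib : ∀ r x y z → (r ∧ (x ∧ z)) xor (r ∧ (y ∧ z)) ≡ r ∧ ((x xor y) ∧ z)
      distrib false x y z = refl
      distrib true  x y z = sym (CommutativeRing.distribʳ xor-∧-commutativeRing z x y)

  χ-comp : ∀ s a w → isValid s a ≡ true → lookup a w ≡ true → χ s a (comp Γ s w) ≡ - 1ℚ
  χ-comp s a w valid-a aw = cong sgn (trans (parity-cong pointwise) (parity-reps s w))
    where
    pointwise : ∀ x → isRep Γ s x ∧ (lookup a x ∧ lookup (comp Γ s w) x) ≡ lookup (comp Γ s w) x ∧ isRep Γ s x
    pointwise x with lookup (comp Γ s w) x in wx
    ... | false = trans (cong (isRep Γ s x ∧_) (∧-zeroʳ (lookup a x))) (∧-zeroʳ (isRep Γ s x))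
    ... | true rewrite trans (sym (path-invariant (lookup a) (isValid⇒invariant s a valid-a) (comp-sound s w x wx))) aw
      = ∧-identityʳ (isRep Γ s x)

  χ-orthogonal : ∀ s a b → isValid s a ≡ true → isValid s b ≡ true →
    ∑Sub n (λ c → if isValid s c then χ s a c * χ s b c else 0ℚ) ≡ (if a ≡ᵛ b then M s else 0ℚ)
  χ-orthogonal s a b valid-a valid-b with ≡-dec _≟ᵇ_ a b
  ... | yes refl = ∑-cong (allSub n) square
    where
    square : ∀ c → (if isValid s c then χ s a c * χ s a c else 0ℚ) ≡ (if isValid s c then 1ℚ else 0ℚ)
    square c with isValid s c
    ... | true  = sgn-sq (pairing s a c)
    ... | false = refl
  -- Translating c by a component on which a ⊕ b is x flips the sign of every term.
  ... | no a≢b with w , differ ← vec-diff a b a≢b =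
    ≡-neg⇒0 _ (trans (sym (∑Sub-translate n F K)) (trans (∑-cong (allSub n) flip) (∑-neg (allSub n) F)))
    where
    F : Sub n → ℚ
    F c = if isValid s c then χ s a c * χ s b c else 0ℚ
    K : Sub n
    K = comp Γ s w
    valid-a⊕b : isValid s (a ⊕ b) ≡ true
    valid-a⊕b = trans (isValid-⊕ s a b valid-b) valid-a
    a⊕b-w : lookup (a ⊕ b) w ≡ true
    a⊕b-w = trans (lookup-⊕ a b w) (≢⇒xor-true differ)
      where
      ≢⇒xor-true : ∀ {x y} → x ≢ y → x xor y ≡ true
      ≢⇒xor-true {x} {y} x≢y = trans (cong (x xor_) (¬-not (x≢y ∘ sym))) (xor-inverseʳ x)
    flip : ∀ c → F (c ⊕ K) ≡ - F c
    flip c rewrite isValid-⊕ s c K (isValid-comp s w) with isValid s c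
    ... | false = refl
    ... | true  = begin
        χ s a (c ⊕ K) * χ s b (c ⊕ K)  ≡⟨ χ-⊕ s a b (c ⊕ K) ⟩
        χ s (a ⊕ b) (c ⊕ K)            ≡⟨ χ-sym s (a ⊕ b) (c ⊕ K) ⟩
        χ s (c ⊕ K) (a ⊕ b)            ≡⟨ χ-⊕ s c K (a ⊕ b) ⟨
        χ s c (a ⊕ b) * χ s K (a ⊕ b)  ≡⟨ cong (χ s c (a ⊕ b) *_) (trans (χ-sym s K (a ⊕ b)) (χ-comp s (a ⊕ b) w valid-a⊕b a⊕b-w)) ⟩
        χ s c (a ⊕ b) * - 1ℚ           ≡⟨ solve 1 (λ x → x :* (:- con 1ℚ) := :- x) refl (χ s c (a ⊕ b)) ⟩
        - χ s c (a ⊕ b)                ≡⟨ cong -_ (trans (χ-sym s c (a ⊕ b)) (sym (χ-⊕ s a b c))) ⟩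
        - (χ s a c * χ s b c)          ∎
      where open ≡-Reasoning

  transform : Sub m → (Sub n → ℚ) → Sub n → ℚ
  transform s G a = ∑Sub n (λ c → if isValid s c then χ s a c * G c else 0ℚ)

  transform-cong : ∀ s {G H : Sub n → ℚ} → (∀ c → isValid s c ≡ true → G c ≡ H c) → ∀ a → transform s G a ≡ transform s H a
  transform-cong s {G} {H} G≡H a = ∑-cong (allSub n) pointwise
    where
    pointwise : ∀ c → (if isValid s c then χ s a c * G c else 0ℚ) ≡ (if isValid s c then χ s a c * H c else 0ℚ)
    pointwise c with isValid s c in valid-c
    ... | true  = cong (χ s a c *_) (G≡H c valid-c)
    ... | false = refl

  transform-*ˡ : ∀ s k G a → transform s (λ c → k * G c) a ≡ k * transform s G a
  transform-*ˡ s k G a = trans (∑-cong (allSub n) pointwise) (∑-*ˡ (allSub n) k _)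
    where
    pointwise : ∀ c → (if isValid s c then χ s a c * (k * G c) else 0ℚ) ≡ k * (if isValid s c then χ s a c * G c else 0ℚ)
    pointwise c = trans (cong (λ x → if isValid s c then x else 0ℚ) (solve 3 (λ x k g → x :* (k :* g) := k :* (x :* g)) refl (χ s a c) k (G c)))
                        (sym (*-if (isValid s c) k _))

  transform-+ : ∀ s G H a → transform s (λ c → G c + H c) a ≡ transform s G a + transform s H a
  transform-+ s G H a = trans (∑-cong (allSub n) pointwise) (∑-+ (allSub n) _ _)
    where
    pointwise : ∀ c → (if isValid s c then χ s a c * (G c + H c) else 0ℚ)
                    ≡ (if isValid s c then χ s a c * G c else 0ℚ) + (if isValid s c then χ s a c * H c else 0ℚ)
    pointwise c with isValid s c
    ... | true  = ℚP.*-distribˡ-+ (χ s a c) (G c) (H c)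
    ... | false = refl

  transform-0 : ∀ s {G} → (∀ c → isValid s c ≡ true → G c ≡ 0ℚ) → ∀ a → transform s G a ≡ 0ℚ
  transform-0 s G≡0 a = trans (transform-cong s G≡0 a) (∑-zero (allSub n) (λ c → if-0 (isValid s c) (ℚP.*-zeroʳ (χ s a c))))

  transform-point : ∀ s c₁ x ℓ → isValid s c₁ ≡ true → transform s (λ c → if c ≡ᵛ c₁ then x else 0ℚ) ℓ ≡ χ s ℓ c₁ * x
  transform-point s c₁ x ℓ valid = trans (∑Sub-point n _ c₁ off) on
    where
    off : ∀ c → c ≢ c₁ → (if isValid s c then χ s ℓ c * (if c ≡ᵛ c₁ then x else 0ℚ) else 0ℚ) ≡ 0ℚ
    off c c≢c₁ rewrite ≢⇒≡ᵛ-false c≢c₁ = if-0 (isValid s c) (ℚP.*-zeroʳ (χ s ℓ c))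
    on : (if isValid s c₁ then χ s ℓ c₁ * (if c₁ ≡ᵛ c₁ then x else 0ℚ) else 0ℚ) ≡ χ s ℓ c₁ * x
    on rewrite valid | ≡ᵛ-refl c₁ = refl

  χ-inversion : ∀ s a → isValid s a ≡ true → (F : Sub n → ℚ) → transform s (transform s F) a ≡ M s * F a
  χ-inversion s a valid-a F = begin
      transform s (transform s F) a
    ≡⟨ ∑-cong (allSub n) expand ⟩
      ∑Sub n (λ c → ∑Sub n (λ b → term c b))
    ≡⟨ ∑-swap (allSub n) (allSub n) term ⟩
      ∑Sub n (λ b → ∑Sub n (λ c → term c b))
    ≡⟨ ∑-cong (allSub n) collect ⟩
      ∑Sub n (λ b → if isValid s b then (if a ≡ᵛ b then M s else 0ℚ) * F b else 0ℚ)
    ≡⟨ ∑Sub-point n _ a off-diagonal ⟩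
      (if isValid s a then (if a ≡ᵛ a then M s else 0ℚ) * F a else 0ℚ)
    ≡⟨ cong₂ (λ p q → if p then (if q then M s else 0ℚ) * F a else 0ℚ) valid-a (≡ᵛ-refl a) ⟩
      M s * F a
    ∎
    where
    open ≡-Reasoning
    term : Sub n → Sub n → ℚ
    term c b = if isValid s c then (if isValid s b then (χ s a c * χ s b c) * F b else 0ℚ) else 0ℚ

    expand : ∀ c → (if isValid s c then χ s a c * transform s F c else 0ℚ) ≡ ∑Sub n (λ b → term c b)
    expand c with isValid s c
    ... | false = sym (∑-0 (allSub n))
    ... | true  = trans (sym (∑-*ˡ (allSub n) (χ s a c) _)) (∑-cong (allSub n) λ b →
      trans (*-if (isValid s b) (χ s a c) _)
            (cong (λ x → if isValid s b then x else 0ℚ)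
                  (trans (cong (λ y → χ s a c * (y * F b)) (χ-sym s c b)) (sym (ℚP.*-assoc (χ s a c) (χ s b c) (F b))))))

    collect : ∀ b → ∑Sub n (λ c → term c b) ≡ (if isValid s b then (if a ≡ᵛ b then M s else 0ℚ) * F b else 0ℚ)
    collect b with isValid s b in valid-b
    ... | false = ∑-zero (allSub n) (λ c → if-0 (isValid s c) refl)
    ... | true  = trans (∑-cong (allSub n) (λ c → sym (if-* (isValid s c) _ (F b))))
                        (trans (∑-*ʳ (allSub n) (F b) _) (cong (_* F b) (χ-orthogonal s a b valid-a valid-b)))

    off-diagonal : ∀ b → b ≢ a → (if isValid s b then (if a ≡ᵛ b then M s else 0ℚ) * F b else 0ℚ) ≡ 0ℚ
    off-diagonal b b≢a rewrite ≢⇒≡ᵛ-false (b≢a ∘ sym) = if-0 (isValid s b) (ℚP.*-zeroˡ (F b))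

  OnValid : Cochain n m → Set
  OnValid f = ∀ s ℓ → isValid s ℓ ≡ false → f (s , ℓ) ≡ 0ℚ

  toChar : Cochain n m → Cochain n m
  toChar f (s , c) = if isValid s c then transform s (λ ℓ → f (s , ℓ)) c else 0ℚ

  fromChar : Cochain n m → Cochain n m
  fromChar g (s , ℓ) = if isValid s ℓ then M⁻¹ s * transform s (λ c → g (s , c)) ℓ else 0ℚ

  toChar-onValid : ∀ f → OnValid (toChar f)
  toChar-onValid f s c invalid rewrite invalid = refl

  fromChar-onValid : ∀ g → OnValid (fromChar g)
  fromChar-onValid g s ℓ invalid rewrite invalid = refl

  fromChar-toChar : ∀ f → OnValid f → fromChar (toChar f) ≈ f
  fromChar-toChar f onValid (s , ℓ) with isValid s ℓ in valid-ℓ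
  ... | false = sym (onValid s ℓ valid-ℓ)
  ... | true  = trans (cong (M⁻¹ s *_) (trans (transform-cong s unfold ℓ) (χ-inversion s ℓ valid-ℓ _))) (M⁻¹-cancel s _)
    where
    unfold : ∀ c → isValid s c ≡ true → toChar f (s , c) ≡ transform s (λ ℓ → f (s , ℓ)) c
    unfold c valid-c rewrite valid-c = refl

  toChar-fromChar : ∀ g → OnValid g → toChar (fromChar g) ≈ g
  toChar-fromChar g onValid (s , c) with isValid s c in valid-c
  ... | false = sym (onValid s c valid-c)
  ... | true  = begin
      transform s (λ ℓ → fromChar g (s , ℓ)) c
    ≡⟨ transform-cong s unfold c ⟩
      transform s (λ ℓ → M⁻¹ s * transform s (λ c → g (s , c)) ℓ) c
    ≡⟨ transform-*ˡ s (M⁻¹ s) _ c ⟩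
      M⁻¹ s * transform s (transform s (λ c → g (s , c))) c
    ≡⟨ cong (M⁻¹ s *_) (χ-inversion s c valid-c _) ⟩
      M⁻¹ s * (M s * g (s , c))
    ≡⟨ M⁻¹-cancel s _ ⟩
      g (s , c)
    ∎
    where
    open ≡-Reasoning
    unfold : ∀ ℓ → isValid s ℓ ≡ true → fromChar g (s , ℓ) ≡ M⁻¹ s * transform s (λ c → g (s , c)) ℓ
    unfold ℓ valid-ℓ rewrite valid-ℓ = refl

  toChar-cong : ∀ {f f′} → f ≈ f′ → toChar f ≈ toChar f′
  toChar-cong f≈f′ (s , c) = cong (λ x → if isValid s c then x else 0ℚ) (transform-cong s (λ ℓ _ → f≈f′ (s , ℓ)) c)

  fromChar-cong : ∀ {g g′} → g ≈ g′ → fromChar g ≈ fromChar g′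
  fromChar-cong g≈g′ (s , ℓ) = cong (λ x → if isValid s ℓ then M⁻¹ s * x else 0ℚ) (transform-cong s (λ c _ → g≈g′ (s , c)) ℓ)

  toChar-0 : ∀ {f} → f ≈ 0c → toChar f ≈ 0c
  toChar-0 f≈0 (s , c) = if-0 (isValid s c) (transform-0 s (λ ℓ _ → f≈0 (s , ℓ)) c)

  fromChar-0-at : ∀ g s → (∀ c → g (s , c) ≡ 0ℚ) → ∀ ℓ → fromChar g (s , ℓ) ≡ 0ℚ
  fromChar-0-at g s g≡0 ℓ = if-0 (isValid s ℓ) (trans (cong (M⁻¹ s *_) (transform-0 s (λ c _ → g≡0 c) ℓ)) (ℚP.*-zeroʳ (M⁻¹ s)))

  fromChar-0 : ∀ {g} → g ≈ 0c → fromChar g ≈ 0c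
  fromChar-0 {g} g≈0 (s , ℓ) = fromChar-0-at g s (λ c → g≈0 (s , c)) ℓ

  fromChar-+ : ∀ g h → fromChar (g +c h) ≈ (fromChar g +c fromChar h)
  fromChar-+ g h (s , ℓ) with isValid s ℓ
  ... | false = sym (ℚP.+-identityˡ 0ℚ)
  ... | true  = trans (cong (M⁻¹ s *_) (transform-+ s _ _ ℓ)) (ℚP.*-distribˡ-+ (M⁻¹ s) _ _)

  fromChar-· : ∀ k g → fromChar (k ·c g) ≈ (k ·c fromChar g)
  fromChar-· k g (s , ℓ) with isValid s ℓ
  ... | false = sym (ℚP.*-zeroʳ k)
  ... | true  = trans (cong (M⁻¹ s *_) (transform-*ˡ s k _ ℓ))
                      (solve 3 (λ a k x → a :* (k :* x) := k :* (a :* x)) refl (M⁻¹ s) k _)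

  -- Adding an edge in character coordinates

  weight : Sub m → Sub n → Sub n → ℚ
  weight t ℓ′ c = if isValid t ℓ′ ∧ isValid t c then M⁻¹ t * χ t ℓ′ c else 0ℚ

  module Deletion (t : Sub m) (e : Fin m) (te : lookup t e ≡ true) where

    s : Sub m
    s = del t e

    u v : Fin n
    u = src Γ e
    v = tgt Γ e

    s⊆t : ∀ e′ → lookup s e′ ≡ true → lookup t e′ ≡ true
    s⊆t e′ = del-⊆ t e

    t⊆s : ∀ e′ → lookup t e′ ≡ true → lookup s e′ ≡ true ⊎ e′ ≡ e
    t⊆s e′ h with e ≟ᶠ e′
    ... | yes refl = inj₂ refl
    ... | no  e≢e′ = inj₁ (trans (lookup-[]≔-other t false e≢e′) h)

    path-s⇒t : ∀ {a b} → Path s a b → Path t a b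
    path-s⇒t = path-mono s⊆t

    e-edge : Edge t u v
    e-edge = edge-of e te

    isValid-t : ∀ ℓ → isValid t ℓ ≡ isValid s ℓ ∧ (lookup ℓ u ≡ᵇ lookup ℓ v)
    isValid-t ℓ = bool-ext restrict extend
      where
      restrict : isValid t ℓ ≡ true → isValid s ℓ ∧ (lookup ℓ u ≡ᵇ lookup ℓ v) ≡ true
      restrict h = cong₂ _∧_ (invariant⇒isValid s ℓ (λ e′ q → isValid⇒invariant t ℓ h e′ (s⊆t e′ q)))
                       (⌊⌋-yes (_ ≟ᵇ _) (isValid⇒invariant t ℓ h e te))
      extend : isValid s ℓ ∧ (lookup ℓ u ≡ᵇ lookup ℓ v) ≡ true → isValid t ℓ ≡ true
      extend h with valid-s , uv ← ∧-true⇒ {isValid s ℓ} h = invariant⇒isValid t ℓ inv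
        where
        inv : Invariant t (lookup ℓ)
        inv e′ q with t⊆s e′ q
        ... | inj₁ q′   = isValid⇒invariant s ℓ valid-s e′ q′
        ... | inj₂ refl = ⌊⌋-true⇒ (_ ≟ᵇ _) uv

    Ku Kv : Sub n
    Ku = comp Γ s u
    Kv = comp Γ s v

    relabel-inside : ∀ ℓ → lookup Ku v ≡ true → relabel s ℓ e ≡ ℓ
    relabel-inside ℓ h with lookup (comp Γ s (src Γ e)) (tgt Γ e) | h
    ... | true | _ = refl

    relabel-across : ∀ ℓ → lookup Ku v ≡ false →
      relabel s ℓ e ≡ tabulate (λ w → if lookup Ku w ∨ lookup Kv w then lookup ℓ u xor lookup ℓ v else lookup ℓ w)
    relabel-across ℓ h with lookup (comp Γ s (src Γ e)) (tgt Γ e) | h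
    ... | false | _ = refl

    -- Adding e to the states of s, written in character coordinates: the character c of s goes to
    -- the character c of t when c is constant across e, and to 0 otherwise.
    MergeKernel : Sub n → Sub n → Set
    MergeKernel ℓ′ c =
      ∑Sub n (λ ℓ → if isValid s ℓ ∧ (relabel s ℓ e ≡ᵛ ℓ′) then M⁻¹ s * χ s ℓ c else 0ℚ)
      ≡ weight t ℓ′ c

    module Inside (uv : lookup Ku v ≡ true) where

      path-t⇒s : ∀ {a b} → Path t a b → Path s a b
      path-t⇒s ε = ε
      path-t⇒s (edge e′ q ends ◅ p) with t⊆s e′ q
      ... | inj₁ q′ = edge e′ q′ ends ◅ path-t⇒s p
      path-t⇒s (edge e′ q (inj₁ (refl , refl)) ◅ p) | inj₂ refl = comp-sound s u v uv ◅◅ path-t⇒s p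
      path-t⇒s (edge e′ q (inj₂ (refl , refl)) ◅ p) | inj₂ refl = path-sym (comp-sound s u v uv) ◅◅ path-t⇒s p

      comp-t≡s : ∀ w → comp Γ t w ≡ comp Γ s w
      comp-t≡s w = vec-ext λ x → bool-ext (λ h → comp-complete s w x (path-t⇒s (comp-sound t w x h)))
                                         (λ h → comp-complete t w x (path-s⇒t (comp-sound s w x h)))

      isRep-t≡s : ∀ w → isRep Γ t w ≡ isRep Γ s w
      isRep-t≡s w = cong (λ C → isLeastIn (lookup C) w) (comp-t≡s w)

      isValid-t≡s : ∀ ℓ → isValid t ℓ ≡ isValid s ℓ
      isValid-t≡s ℓ rewrite isValid-t ℓ with isValid s ℓ in h
      ... | false = refl
      ... | true  = ⌊⌋-yes (_ ≟ᵇ _) (path-invariant (lookup ℓ) (isValid⇒invariant s ℓ h) (comp-sound s u v uv))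

      merge-kernel : ∀ ℓ′ c → isValid s c ≡ true → MergeKernel ℓ′ c
      merge-kernel ℓ′ c valid-c = trans (∑Sub-point n _ ℓ′ off) on
        where
        off : ∀ ℓ → ℓ ≢ ℓ′ → (if isValid s ℓ ∧ (relabel s ℓ e ≡ᵛ ℓ′) then M⁻¹ s * χ s ℓ c else 0ℚ) ≡ 0ℚ
        off ℓ ℓ≢ℓ′ rewrite relabel-inside ℓ uv | ≢⇒≡ᵛ-false ℓ≢ℓ′ | ∧-zeroʳ (isValid s ℓ) = refl
        M-t≡s : M t ≡ M s
        M-t≡s = ∑-cong (allSub n) (λ x → cong (λ b → if b then 1ℚ else 0ℚ) (isValid-t≡s x))
        χ-t≡s : χ t ℓ′ c ≡ χ s ℓ′ c
        χ-t≡s = cong sgn (parity-cong (λ w → cong (_∧ (lookup ℓ′ w ∧ lookup c w)) (isRep-t≡s w)))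
        on : (if isValid s ℓ′ ∧ (relabel s ℓ′ e ≡ᵛ ℓ′) then M⁻¹ s * χ s ℓ′ c else 0ℚ)
           ≡ weight t ℓ′ c
        on = trans (cong (λ b → if isValid s ℓ′ ∧ b then M⁻¹ s * χ s ℓ′ c else 0ℚ)
                         (trans (cong (_≡ᵛ ℓ′) (relabel-inside ℓ′ uv)) (≡ᵛ-refl ℓ′)))
                   (sym (cong₂ (λ b x → if b then x else 0ℚ)
                               (cong₂ _∧_ (isValid-t≡s ℓ′) (trans (isValid-t≡s c) valid-c))
                               (cong₂ _*_ (M⁻¹-cong {t} {s} M-t≡s) χ-t≡s)))

    module Across (uv : lookup Ku v ≡ false) where

      K : Fin n → Bool
      K w = lookup Ku w ∨ lookup Kv w

      Ku-u : lookup Ku u ≡ true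
      Ku-u = comp-self s u

      Kv-v : lookup Kv v ≡ true
      Kv-v = comp-self s v

      Ku∩Kv=∅ : ∀ w → lookup Ku w ≡ true → lookup Kv w ≡ false
      Ku∩Kv=∅ w wu = ¬-not λ wv →
        false≢true (trans (sym uv) (comp-complete s u v (comp-sound s u w wu ◅◅ path-sym (comp-sound s v w wv))))

      u∉Kv : lookup Kv u ≡ false
      u∉Kv = Ku∩Kv=∅ u Ku-u

      K-u : K u ≡ true
      K-u = cong (_∨ lookup Kv u) Ku-u

      K-v : K v ≡ true
      K-v = trans (cong (lookup Ku v ∨_) Kv-v) (∨-zeroʳ _)

      K-false : ∀ w → K w ≡ false → lookup Ku w ≡ false × lookup Kv w ≡ false
      K-false w Kw with lookup Ku w | lookup Kv w | Kw
      ... | false | false | _ = refl , refl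

      K-invariant : Invariant t K
      K-invariant e′ q with t⊆s e′ q
      ... | inj₁ q′   = cong₂ _∨_ (comp-invariant s u e′ q′) (comp-invariant s v e′ q′)
      ... | inj₂ refl = trans K-u (sym K-v)

      path-outside : ∀ {a b} → K a ≡ false → Path t a b → Path s a b
      path-outside Ka ε = ε
      path-outside Ka (edge e′ q ends ◅ p) with t⊆s e′ q
      ... | inj₁ q′ = edge e′ q′ ends ◅ path-outside (trans (sym (path-invariant {t} K K-invariant (edge e′ q ends ◅ ε))) Ka) p
      path-outside Ka (edge e′ q (inj₁ (refl , refl)) ◅ p) | inj₂ refl = ⊥-elim (false≢true (trans (sym Ka) K-u))
      path-outside Ka (edge e′ q (inj₂ (refl , refl)) ◅ p) | inj₂ refl = ⊥-elim (false≢true (trans (sym Ka) K-v))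

      comp-outside : ∀ w → K w ≡ false → comp Γ t w ≡ comp Γ s w
      comp-outside w Kw = vec-ext λ x → bool-ext (λ h → comp-complete s w x (path-outside Kw (comp-sound t w x h)))
                                                 (λ h → comp-complete t w x (path-s⇒t (comp-sound s w x h)))

      isRep-outside : ∀ w → K w ≡ false → isRep Γ t w ≡ isRep Γ s w
      isRep-outside w Kw = cong (λ C → isLeastIn (lookup C) w) (comp-outside w Kw)

      path-to-u : ∀ y → K y ≡ true → Path t y u
      path-to-u y Ky with ∨-true⇒ Ky
      ... | inj₁ yu = path-s⇒t (path-sym (comp-sound s u y yu))
      ... | inj₂ yv = path-s⇒t (path-sym (comp-sound s v y yv)) ◅◅ (edge-sym e-edge ◅ ε)

      comp-inside : ∀ w → K w ≡ true → ∀ x → lookup (comp Γ t w) x ≡ K x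
      comp-inside w Kw x = bool-ext (λ h → trans (sym (path-invariant K K-invariant (comp-sound t w x h))) Kw)
                                    (λ h → comp-complete t w x (path-to-u w Kw ◅◅ path-sym (path-to-u x h)))

      parity-reps-t : parity (λ w → K w ∧ isRep Γ t w) ≡ true
      parity-reps-t = trans (parity-cong on-K) (parity-least K u K-u)
        where
        on-K : ∀ w → K w ∧ isRep Γ t w ≡ K w ∧ isLeastIn K w
        on-K w with K w in Kw
        ... | false = refl
        ... | true  = isLeastIn-cong (comp-inside w Kw) w

      relabel-lookup : ∀ ℓ w → lookup (relabel s ℓ e) w ≡ (if K w then lookup ℓ u xor lookup ℓ v else lookup ℓ w)
      relabel-lookup ℓ w = trans (cong (λ X → lookup X w) (relabel-across ℓ uv)) (lookup∘tabulate _ w)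

      relabel-valid : ∀ ℓ → isValid s ℓ ≡ true → isValid t (relabel s ℓ e) ≡ true
      relabel-valid ℓ valid-ℓ = invariant⇒isValid t (relabel s ℓ e) inv
        where
        outside-edge : ∀ e′ → lookup t e′ ≡ true → K (src Γ e′) ≡ false → lookup ℓ (src Γ e′) ≡ lookup ℓ (tgt Γ e′)
        outside-edge e′ q K-src with t⊆s e′ q
        ... | inj₁ q′   = isValid⇒invariant s ℓ valid-ℓ e′ q′
        ... | inj₂ refl = ⊥-elim (false≢true (trans (sym K-src) K-u))
        inv : Invariant t (lookup (relabel s ℓ e))
        inv e′ q rewrite relabel-lookup ℓ (src Γ e′) | relabel-lookup ℓ (tgt Γ e′) | K-invariant e′ q
          with K (tgt Γ e′) in K-tgt
        ... | true  = refl
        ... | false = outside-edge e′ q (trans (K-invariant e′ q) K-tgt)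

      M-across : M s ≡ M t + M t
      M-across = trans (∑-cong (allSub n) split)
        (trans (∑-+ (allSub n) _ _) (cong (M t +_) (trans (sym (∑Sub-translate n cut Kv)) (∑-cong (allSub n) shift))))
        where
        cut : Sub n → ℚ
        cut c = if isValid s c ∧ not (lookup c u ≡ᵇ lookup c v) then 1ℚ else 0ℚ
        split : ∀ c → (if isValid s c then 1ℚ else 0ℚ) ≡ (if isValid t c then 1ℚ else 0ℚ) + cut c
        split c rewrite isValid-t c with isValid s c | lookup c u ≡ᵇ lookup c v
        ... | true  | true  = refl
        ... | true  | false = refl
        ... | false | _     = refl
        ≡ᵇ-flip : ∀ a b → not (a ≡ᵇ (b xor true)) ≡ (a ≡ᵇ b)
        ≡ᵇ-flip true  true  = refl
        ≡ᵇ-flip true  false = refl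
        ≡ᵇ-flip false true  = refl
        ≡ᵇ-flip false false = refl
        shift : ∀ c → cut (c ⊕ Kv) ≡ (if isValid t c then 1ℚ else 0ℚ)
        shift c rewrite isValid-⊕ s c Kv (isValid-comp s v) | lookup-⊕ c Kv u | lookup-⊕ c Kv v | u∉Kv | Kv-v
                      | xor-identityʳ (lookup c u) | ≡ᵇ-flip (lookup c u) (lookup c v) | isValid-t c = refl

      module Fibre (ℓ′ : Sub n) (valid-ℓ′ : isValid t ℓ′ ≡ true) where

        γ : Bool
        γ = lookup ℓ′ u

        ℓ′-on-K : ∀ w → K w ≡ true → lookup ℓ′ w ≡ γ
        ℓ′-on-K w Kw = path-invariant (lookup ℓ′) (isValid⇒invariant t ℓ′ valid-ℓ′) (path-to-u w Kw)

        lift : Bool → Sub n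
        lift b = tabulate λ w → if lookup Ku w then b else if lookup Kv w then b xor γ else lookup ℓ′ w

        lookup-lift : ∀ b w → lookup (lift b) w ≡ (if lookup Ku w then b else if lookup Kv w then b xor γ else lookup ℓ′ w)
        lookup-lift b w = lookup∘tabulate _ w

        lift-u : ∀ b → lookup (lift b) u ≡ b
        lift-u b rewrite lookup-lift b u | Ku-u = refl

        lift-v : ∀ b → lookup (lift b) v ≡ b xor γ
        lift-v b rewrite lookup-lift b v | uv | Kv-v = refl

        lift-distinct : lift false ≢ lift true
        lift-distinct eq = false≢true (trans (sym (lift-u false)) (trans (cong (λ X → lookup X u) eq) (lift-u true)))

        lift-valid : ∀ b → isValid s (lift b) ≡ true
        lift-valid b = invariant⇒isValid s (lift b) λ e′ q →
          trans (lookup-lift b (src Γ e′)) (trans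
            (cong₂ (λ x y → if x then b else if y then b xor γ else lookup ℓ′ (src Γ e′))
                   (comp-invariant s u e′ q) (comp-invariant s v e′ q))
            (trans (cong (λ z → if lookup Ku (tgt Γ e′) then b else if lookup Kv (tgt Γ e′) then b xor γ else z)
                         (isValid⇒invariant t ℓ′ valid-ℓ′ e′ (s⊆t e′ q)))
                   (sym (lookup-lift b (tgt Γ e′)))))

        relabel-lift : ∀ b → relabel s (lift b) e ≡ ℓ′
        relabel-lift b = vec-ext λ w → trans (relabel-lookup (lift b) w) (pointwise w)
          where
          pointwise : ∀ w → (if K w then lookup (lift b) u xor lookup (lift b) v else lookup (lift b) w) ≡ lookup ℓ′ w
          pointwise w with K w in Kw
          ... | true  rewrite lift-u b | lift-v b = trans (xor-cancelˡ b γ) (sym (ℓ′-on-K w Kw))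
          ... | false with Ku-w , Kv-w ← K-false w Kw rewrite lookup-lift b w | Ku-w | Kv-w = refl

        preimage : ∀ ℓ → isValid s ℓ ≡ true → relabel s ℓ e ≡ ℓ′ → ℓ ≡ lift (lookup ℓ u)
        preimage ℓ valid-ℓ relabel≡ = vec-ext λ w → trans (pointwise w) (sym (lookup-lift (lookup ℓ u) w))
          where
          relabel-at : ∀ w → (if K w then lookup ℓ u xor lookup ℓ v else lookup ℓ w) ≡ lookup ℓ′ w
          relabel-at w = trans (sym (relabel-lookup ℓ w)) (cong (λ X → lookup X w) relabel≡)
          along : ∀ a w → lookup (comp Γ s a) w ≡ true → lookup ℓ w ≡ lookup ℓ a
          along a w aw = sym (path-invariant (lookup ℓ) (isValid⇒invariant s ℓ valid-ℓ) (comp-sound s a w aw))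
          ℓ-v : lookup ℓ v ≡ lookup ℓ u xor γ
          ℓ-v = trans (sym (xor-cancelˡ (lookup ℓ u) (lookup ℓ v)))
                      (cong (lookup ℓ u xor_) (trans (sym (cong (λ b → if b then lookup ℓ u xor lookup ℓ v else lookup ℓ u) K-u)) (relabel-at u)))
          pointwise : ∀ w → lookup ℓ w ≡ (if lookup Ku w then lookup ℓ u else if lookup Kv w then lookup ℓ u xor γ else lookup ℓ′ w)
          pointwise w with lookup Ku w in Ku-w
          ... | true = along u w Ku-w
          ... | false with lookup Kv w in Kv-w
          ...   | true  = trans (along v w Kv-w) ℓ-v
          ...   | false = trans (sym (cong (λ b → if b then _ else lookup ℓ w) (cong₂ _∨_ Ku-w Kv-w))) (relabel-at w)

        fibre-sum : ∀ (F : Sub n → ℚ) →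
          ∑Sub n (λ ℓ → if isValid s ℓ ∧ (relabel s ℓ e ≡ᵛ ℓ′) then F ℓ else 0ℚ) ≡ F (lift false) + F (lift true)
        fibre-sum F = trans (∑-cong (allSub n) split) (trans (∑-+ (allSub n) _ _) (cong₂ _+_ (at (lift false)) (at (lift true))))
          where
          at : ∀ a → ∑Sub n (λ ℓ → if ℓ ≡ᵛ a then F ℓ else 0ℚ) ≡ F a
          at a = trans (∑Sub-point n _ a (λ ℓ ℓ≢a → cong (λ b → if b then F ℓ else 0ℚ) (≢⇒≡ᵛ-false ℓ≢a)))
                       (cong (λ b → if b then F a else 0ℚ) (≡ᵛ-refl a))
          in-fibre : ∀ b → isValid s (lift b) ∧ (relabel s (lift b) e ≡ᵛ ℓ′) ≡ true
          in-fibre b rewrite lift-valid b | relabel-lift b = ≡ᵛ-refl ℓ′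
          split : ∀ ℓ → (if isValid s ℓ ∧ (relabel s ℓ e ≡ᵛ ℓ′) then F ℓ else 0ℚ)
                      ≡ (if ℓ ≡ᵛ lift false then F ℓ else 0ℚ) + (if ℓ ≡ᵛ lift true then F ℓ else 0ℚ)
          split ℓ with ≡-dec _≟ᵇ_ ℓ (lift false) | ≡-dec _≟ᵇ_ ℓ (lift true)
          ... | yes refl | yes eq   = ⊥-elim (lift-distinct eq)
          ... | yes refl | no _     rewrite in-fibre false = sym (ℚP.+-identityʳ _)
          ... | no _     | yes refl rewrite in-fibre true  = sym (ℚP.+-identityˡ _)
          ... | no ≢f    | no ≢t with isValid s ℓ in valid-ℓ | ≡-dec _≟ᵇ_ (relabel s ℓ e) ℓ′
          ...   | false | _       = refl
          ...   | true  | no _    = refl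
          ...   | true  | yes rel = ⊥-elim (not-lift (lookup ℓ u) (preimage ℓ valid-ℓ rel))
            where
            not-lift : ∀ b → ℓ ≢ lift b
            not-lift false = ≢f
            not-lift true  = ≢t

        outside : Sub n → Bool
        outside c = parity (λ w → not (lookup Ku w ∨ lookup Kv w) ∧ (isRep Γ s w ∧ (lookup ℓ′ w ∧ lookup c w)))

        pairing-lift : ∀ c → isValid s c ≡ true → ∀ b →
          pairing s (lift b) c ≡ (b ∧ lookup c u) xor (((b xor γ) ∧ lookup c v) xor outside c)
        pairing-lift c valid-c b = begin
            pairing s (lift b) c
          ≡⟨ parity-cong pointwise ⟩
            parity (λ w → inKu w xor (inKv w xor rest w))
          ≡⟨ parity-xor inKu _ ⟩
            parity inKu xor parity (λ w → inKv w xor rest w)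
          ≡⟨ cong (parity inKu xor_) (parity-xor inKv rest) ⟩
            parity inKu xor (parity inKv xor outside c)
          ≡⟨ cong₂ (λ x y → x xor (y xor outside c))
                   (parity-∧-const {n} (λ w → lookup Ku w ∧ isRep Γ s w) _ (parity-reps s u))
                   (parity-∧-const {n} (λ w → lookup Kv w ∧ isRep Γ s w) _ (parity-reps s v)) ⟩
            (b ∧ lookup c u) xor (((b xor γ) ∧ lookup c v) xor outside c)
          ∎
          where
          open ≡-Reasoning
          inKu inKv rest : Fin n → Bool
          inKu w = (lookup Ku w ∧ isRep Γ s w) ∧ (b ∧ lookup c u)
          inKv w = (lookup Kv w ∧ isRep Γ s w) ∧ ((b xor γ) ∧ lookup c v)
          rest w = not (lookup Ku w ∨ lookup Kv w) ∧ (isRep Γ s w ∧ (lookup ℓ′ w ∧ lookup c w))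
          c-along : ∀ a w → lookup (comp Γ s a) w ≡ true → lookup c w ≡ lookup c a
          c-along a w aw = sym (path-invariant (lookup c) (isValid⇒invariant s c valid-c) (comp-sound s a w aw))
          pointwise : ∀ w → isRep Γ s w ∧ (lookup (lift b) w ∧ lookup c w) ≡ inKu w xor (inKv w xor rest w)
          pointwise w rewrite lookup-lift b w with lookup Ku w in Ku-w
          ... | true  rewrite Ku∩Kv=∅ w Ku-w | c-along u w Ku-w = sym (xor-identityʳ _)
          ... | false with lookup Kv w in Kv-w
          ...   | true  rewrite c-along v w Kv-w = sym (xor-identityʳ _)
          ...   | false = refl

        pairing-t : ∀ c → isValid t c ≡ true → pairing t ℓ′ c ≡ (γ ∧ lookup c u) xor outside c
        pairing-t c valid-c = begin
            pairing t ℓ′ c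
          ≡⟨ parity-cong pointwise ⟩
            parity (λ w → inK w xor rest w)
          ≡⟨ parity-xor inK rest ⟩
            parity inK xor outside c
          ≡⟨ cong (_xor outside c) (parity-∧-const {n} (λ w → K w ∧ isRep Γ t w) _ parity-reps-t) ⟩
            (γ ∧ lookup c u) xor outside c
          ∎
          where
          open ≡-Reasoning
          inK rest : Fin n → Bool
          inK w = (K w ∧ isRep Γ t w) ∧ (γ ∧ lookup c u)
          rest w = not (lookup Ku w ∨ lookup Kv w) ∧ (isRep Γ s w ∧ (lookup ℓ′ w ∧ lookup c w))
          pointwise : ∀ w → isRep Γ t w ∧ (lookup ℓ′ w ∧ lookup c w) ≡ inK w xor rest w
          pointwise w with K w in Kw
          ... | true  rewrite ℓ′-on-K w Kw
                            | path-invariant (lookup c) (isValid⇒invariant t c valid-c) (path-to-u w Kw) = sym (xor-identityʳ _)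
          ... | false rewrite isRep-outside w Kw = refl

        fibre-total : ∀ c → isValid s c ≡ true →
          M⁻¹ s * χ s (lift false) c + M⁻¹ s * χ s (lift true) c ≡ (if isValid t c then M⁻¹ t * χ t ℓ′ c else 0ℚ)
        fibre-total c valid-c = begin
            M⁻¹ s * χ s (lift false) c + M⁻¹ s * χ s (lift true) c
          ≡⟨ cong₂ (λ x y → M⁻¹ s * sgn x + M⁻¹ s * sgn y) (shape false) (shape true) ⟩
            M⁻¹ s * sgn P + M⁻¹ s * sgn ((true ∧ δ) xor P)
          ≡⟨ sgn-fibre (M⁻¹ s) δ P ⟩
            (if not δ then (M⁻¹ s + M⁻¹ s) * sgn P else 0ℚ)
          ≡⟨ cong (λ b → if b then (M⁻¹ s + M⁻¹ s) * sgn P else 0ℚ) valid-t-c ⟨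
            (if isValid t c then (M⁻¹ s + M⁻¹ s) * sgn P else 0ℚ)
          ≡⟨ if-congʳ (isValid t c) (λ valid-t → cong₂ _*_ (M⁻¹-half {s} {t} M-across) (cong sgn (sym (pairing-t≡P valid-t)))) ⟩
            (if isValid t c then M⁻¹ t * χ t ℓ′ c else 0ℚ)
          ∎
          where
          open ≡-Reasoning
          δ P : Bool
          δ = lookup c u xor lookup c v
          P = (γ ∧ lookup c v) xor outside c
          shape : ∀ b → pairing s (lift b) c ≡ (b ∧ δ) xor P
          shape b = trans (pairing-lift c valid-c b) (xor-shape b (lookup c u) (lookup c v) γ (outside c))
          valid-t-c : isValid t c ≡ not δ
          valid-t-c = trans (isValid-t c) (trans (cong (_∧ (lookup c u ≡ᵇ lookup c v)) valid-c) (≡ᵇ-as-xor (lookup c u) (lookup c v)))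
          pairing-t≡P : isValid t c ≡ true → pairing t ℓ′ c ≡ P
          pairing-t≡P valid-t = trans (pairing-t c valid-t)
            (cong (λ x → (γ ∧ x) xor outside c) (isValid⇒invariant t c valid-t e te))

      merge-kernel : ∀ ℓ′ c → isValid s c ≡ true → MergeKernel ℓ′ c
      merge-kernel ℓ′ c valid-c with isValid t ℓ′ in valid-ℓ′
      ... | false = ∑-zero (allSub n) no-preimage
        where
        no-preimage : ∀ ℓ → (if isValid s ℓ ∧ (relabel s ℓ e ≡ᵛ ℓ′) then M⁻¹ s * χ s ℓ c else 0ℚ) ≡ 0ℚ
        no-preimage ℓ with isValid s ℓ in valid-ℓ | ≡-dec _≟ᵇ_ (relabel s ℓ e) ℓ′
        ... | false | _        = refl
        ... | true  | no _     = refl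
        ... | true  | yes refl = ⊥-elim (false≢true (trans (sym valid-ℓ′) (relabel-valid ℓ valid-ℓ)))
      ... | true  = trans (fibre-sum (λ ℓ → M⁻¹ s * χ s ℓ c)) (fibre-total c valid-c)
        where open Fibre ℓ′ valid-ℓ′

    merge-kernel : ∀ ℓ′ c → isValid s c ≡ true → MergeKernel ℓ′ c
    merge-kernel ℓ′ c valid-c = by-cases (lookup Ku v) refl
      where
      by-cases : ∀ b → lookup Ku v ≡ b → MergeKernel ℓ′ c
      by-cases true  uv = Inside.merge-kernel uv ℓ′ c valid-c
      by-cases false uv = Across.merge-kernel uv ℓ′ c valid-c

    merged-fromChar : ∀ g ℓ′ → ∑Sub n (λ ℓ → if isValid s ℓ ∧ (relabel s ℓ e ≡ᵛ ℓ′) then fromChar g (s , ℓ) else 0ℚ)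
                            ≡ ∑Sub n (λ c → weight t ℓ′ c * g (s , c))
    merged-fromChar g ℓ′ = begin
        ∑Sub n (λ ℓ → if Pr ℓ then fromChar g (s , ℓ) else 0ℚ)
      ≡⟨ ∑-cong (allSub n) expand ⟩
        ∑Sub n (λ ℓ → ∑Sub n (λ c → term ℓ c))
      ≡⟨ ∑-swap (allSub n) (allSub n) term ⟩
        ∑Sub n (λ c → ∑Sub n (λ ℓ → term ℓ c))
      ≡⟨ ∑-cong (allSub n) collect ⟩
        ∑Sub n (λ c → weight t ℓ′ c * g (s , c))
      ∎
      where
      open ≡-Reasoning
      Pr : Sub n → Bool
      Pr ℓ = isValid s ℓ ∧ (relabel s ℓ e ≡ᵛ ℓ′)
      term : Sub n → Sub n → ℚ
      term ℓ c = if isValid s c then (if Pr ℓ then M⁻¹ s * χ s ℓ c else 0ℚ) * g (s , c) else 0ℚ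
      expand : ∀ ℓ → (if Pr ℓ then fromChar g (s , ℓ) else 0ℚ) ≡ ∑Sub n (λ c → term ℓ c)
      expand ℓ with isValid s ℓ | relabel s ℓ e ≡ᵛ ℓ′
      ... | true  | true  = trans (sym (∑-*ˡ (allSub n) (M⁻¹ s) _)) (∑-cong (allSub n) λ c →
            trans (*-if (isValid s c) (M⁻¹ s) _) (cong (λ x → if isValid s c then x else 0ℚ) (sym (ℚP.*-assoc (M⁻¹ s) _ _))))
      ... | true  | false = sym (∑-zero (allSub n) (λ c → if-0 (isValid s c) (ℚP.*-zeroˡ (g (s , c)))))
      ... | false | _     = sym (∑-zero (allSub n) (λ c → if-0 (isValid s c) (ℚP.*-zeroˡ (g (s , c)))))
      collect : ∀ c → ∑Sub n (λ ℓ → term ℓ c) ≡ weight t ℓ′ c * g (s , c)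
      collect c with isValid s c in valid-c
      ... | true  = trans (∑-*ʳ (allSub n) (g (s , c)) _) (cong (_* g (s , c)) (merge-kernel ℓ′ c valid-c))
      ... | false = trans (∑-0 (allSub n)) (sym (trans (cong (_* g (s , c)) weight-0) (ℚP.*-zeroˡ (g (s , c)))))
        where
        weight-0 : weight t ℓ′ c ≡ 0ℚ
        weight-0 rewrite isValid-t c | valid-c | ∧-zeroʳ (isValid t ℓ′) = refl

  -- For each colouring c, the simplicial coboundary of the full simplex on the c-monochromatic edges.
  Dχ : Cochain n m → Cochain n m
  Dχ g (t , c) = if isValid t c
    then ∑Fin m (λ e → if lookup t e then sign (nse (del t e) e) * g (del t e , c) else 0ℚ)
    else 0ℚ

  private
    weighted-term : Cochain n m → Sub m → Sub n → Fin m → ℚ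
    weighted-term g t ℓ′ e = if lookup t e
      then sign (nse (del t e) e) * ∑Sub n (λ c → weight t ℓ′ c * g (del t e , c))
      else 0ℚ

    D-term-fromChar : ∀ g t ℓ′ e → D-term (fromChar g) t ℓ′ e ≡ weighted-term g t ℓ′ e
    D-term-fromChar g t ℓ′ e with lookup t e in te
    ... | false = refl
    ... | true  = cong (sign (nse (del t e) e) *_) (Deletion.merged-fromChar t e te g ℓ′)

    fromChar-Dχ : ∀ g t ℓ′ → fromChar (Dχ g) (t , ℓ′) ≡ ∑Fin m (weighted-term g t ℓ′)
    fromChar-Dχ g t ℓ′ = begin
        fromChar (Dχ g) (t , ℓ′)
      ≡⟨ expand ⟩
        ∑Sub n (λ c → ∑Fin m (λ e → if lookup t e then sign (nse (del t e) e) * (weight t ℓ′ c * g (del t e , c)) else 0ℚ))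
      ≡⟨ ∑-swap (allSub n) (allFin m) _ ⟩
        ∑Fin m (λ e → ∑Sub n (λ c → if lookup t e then sign (nse (del t e) e) * (weight t ℓ′ c * g (del t e , c)) else 0ℚ))
      ≡⟨ ∑-cong (allFin m) pull-sign ⟩
        ∑Fin m (weighted-term g t ℓ′)
      ∎
      where
      open ≡-Reasoning
      pull-sign : ∀ e → ∑Sub n (λ c → if lookup t e then sign (nse (del t e) e) * (weight t ℓ′ c * g (del t e , c)) else 0ℚ)
                      ≡ weighted-term g t ℓ′ e
      pull-sign e with lookup t e
      ... | true  = ∑-*ˡ (allSub n) (sign (nse (del t e) e)) _
      ... | false = ∑-0 (allSub n)
      term-0 : ∀ e {w x} → w ≡ 0ℚ → (if lookup t e then sign (nse (del t e) e) * (w * x) else 0ℚ) ≡ 0ℚ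
      term-0 e {w} {x} w≡0 = if-0 (lookup t e) (trans (cong (λ y → sign (nse (del t e) e) * (y * x)) w≡0)
                                                      (trans (cong (sign (nse (del t e) e) *_) (ℚP.*-zeroˡ x)) (ℚP.*-zeroʳ (sign (nse (del t e) e)))))
      expand : fromChar (Dχ g) (t , ℓ′)
             ≡ ∑Sub n (λ c → ∑Fin m (λ e → if lookup t e then sign (nse (del t e) e) * (weight t ℓ′ c * g (del t e , c)) else 0ℚ))
      expand with isValid t ℓ′
      ... | false = sym (∑-zero (allSub n) (λ c → ∑-zero (allFin m) (λ e → term-0 e {x = g (del t e , c)} refl)))
      ... | true  = trans (sym (∑-*ˡ (allSub n) (M⁻¹ t) _)) (∑-cong (allSub n) per-c)
        where
        per-c : ∀ c → M⁻¹ t * (if isValid t c then χ t ℓ′ c * Dχ g (t , c) else 0ℚ)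
                    ≡ ∑Fin m (λ e → if lookup t e
                                    then sign (nse (del t e) e) * ((if isValid t c then M⁻¹ t * χ t ℓ′ c else 0ℚ) * g (del t e , c))
                                    else 0ℚ)
        per-c c with isValid t c
        ... | false = trans (ℚP.*-zeroʳ (M⁻¹ t)) (sym (∑-zero (allFin m) (λ e → term-0 e {x = g (del t e , c)} refl)))
        ... | true  = trans (sym (ℚP.*-assoc (M⁻¹ t) (χ t ℓ′ c) _))
                        (trans (sym (∑-*ˡ (allFin m) (M⁻¹ t * χ t ℓ′ c) _)) (∑-cong (allFin m) λ e →
                          trans (*-if (lookup t e) (M⁻¹ t * χ t ℓ′ c) (sign (nse (del t e) e) * g (del t e , c)))
                                (cong (λ x → if lookup t e then x else 0ℚ)
                                      (solve 3 (λ a b x → a :* (b :* x) := b :* (a :* x)) refl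
                                             (M⁻¹ t * χ t ℓ′ c) (sign (nse (del t e) e)) (g (del t e , c))))))

  D∘fromChar : ∀ g → D Γ (fromChar g) ≈ fromChar (Dχ g)
  D∘fromChar g (t , ℓ′) = trans (D-expand (fromChar g) t ℓ′)
    (trans (∑-cong (allFin m) (D-term-fromChar g t ℓ′)) (sym (fromChar-Dχ g t ℓ′)))

  -- The contracting homotopy

  monochromatic : Sub n → Fin m → Bool
  monochromatic c e = lookup c (src Γ e) ≡ᵇ lookup c (tgt Γ e)

  private
    witness : ∀ {P : Fin m → Set} → Dec (∃ P) → Maybe (Fin m)
    witness (yes (e , _)) = just e
    witness (no _)        = nothing

    witness-just : ∀ {P : Fin m → Set} (d : Dec (∃ P)) {e₀} → witness d ≡ just e₀ → P e₀
    witness-just (yes (e , p)) refl = p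

    witness-nothing : ∀ {P : Fin m → Set} (d : Dec (∃ P)) → witness d ≡ nothing → ∀ e → ¬ P e
    witness-nothing (no none) _ e p = none (e , p)

  pick : Sub n → Maybe (Fin m)
  pick c = witness (any? (λ e → monochromatic c e ≟ᵇ true))

  pick-just : ∀ c {e₀} → pick c ≡ just e₀ → monochromatic c e₀ ≡ true
  pick-just c = witness-just (any? (λ e → monochromatic c e ≟ᵇ true))

  pick-nothing : ∀ c → pick c ≡ nothing → ∀ e → monochromatic c e ≡ false
  pick-nothing c none e = ¬-not (witness-nothing (any? (λ e → monochromatic c e ≟ᵇ true)) none e)

  pick-none : ∀ c → (∀ e → monochromatic c e ≡ false) → pick c ≡ nothing
  pick-none c none with any? (λ e → monochromatic c e ≟ᵇ true)
  ... | yes (e , mono) = ⊥-elim (false≢true (trans (sym (none e)) mono))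
  ... | no  _          = refl

  isValid-del : ∀ s c e → isValid s c ≡ true → isValid (del s e) c ≡ true
  isValid-del s c e valid = invariant⇒isValid (del s e) c λ e′ q → isValid⇒invariant s c valid e′ (del-⊆ s e q)

  isValid-add : ∀ s c e → isValid s c ≡ true → monochromatic c e ≡ true → isValid (add s e) c ≡ true
  isValid-add s c e valid mono = invariant⇒isValid (add s e) c inv
    where
    inv : Invariant (add s e) (lookup c)
    inv e′ q with e ≟ᶠ e′
    ... | yes refl = ⌊⌋-true⇒ (_ ≟ᵇ _) mono
    ... | no  e≢e′ = isValid⇒invariant s c valid e′ (trans (sym (lookup-[]≔-other s true e≢e′)) q)

  Dχ-at : ∀ g s c → isValid s c ≡ true →
    Dχ g (s , c) ≡ ∑Fin m (λ e → if lookup s e then sign (nse (del s e) e) * g (del s e , c) else 0ℚ)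
  Dχ-at g s c valid rewrite valid = refl

  Dχ-onValid : ∀ g → OnValid (Dχ g)
  Dχ-onValid g s c invalid rewrite invalid = refl

  step-to : Fin m → Cochain n m → Sub m → Sub n → ℚ
  step-to e₀ g s c = if lookup s e₀ then 0ℚ else sign (nse s e₀) * g (add s e₀ , c)

  -- Cone on the chosen monochromatic edge; the choice depends on c only, as Dχ preserves c.
  homotopy : Cochain n m → Cochain n m
  homotopy g (s , c) with isValid s c | pick c
  ... | true | just e₀ = step-to e₀ g s c
  ... | _    | _       = 0ℚ

  homotopy-at : ∀ g s c {e₀} → isValid s c ≡ true → pick c ≡ just e₀ → homotopy g (s , c) ≡ step-to e₀ g s c
  homotopy-at g s c valid picked rewrite valid | picked = refl

  private
    homotopy-term : Cochain n m → Sub m → Sub n → Fin m → Fin m → ℚ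
    homotopy-term g s c e₀ e = if lookup s e then sign (nse (del s e) e) * step-to e₀ g (del s e) c else 0ℚ

    homotopy-e₀∈s : ∀ g s c e₀ → lookup s e₀ ≡ true → ∑Fin m (homotopy-term g s c e₀) ≡ g (s , c)
    homotopy-e₀∈s g s c e₀ se₀ = trans (∑Fin-point m _ e₀ off) on
      where
      off : ∀ e → e ≢ e₀ → homotopy-term g s c e₀ e ≡ 0ℚ
      off e e≢e₀ = if-0 (lookup s e) (trans
        (cong (λ b → sign (nse (del s e) e) * (if b then 0ℚ else sign (nse (del s e) e₀) * g (add (del s e) e₀ , c)))
              (trans (lookup-[]≔-other s false e≢e₀) se₀))
        (ℚP.*-zeroʳ (sign (nse (del s e) e))))
      σ : ℚ
      σ = sign (nse (del s e₀) e₀)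
      on : homotopy-term g s c e₀ e₀ ≡ g (s , c)
      on = begin
          homotopy-term g s c e₀ e₀
        ≡⟨ cong (λ b → if b then σ * step-to e₀ g (del s e₀) c else 0ℚ) se₀ ⟩
          σ * step-to e₀ g (del s e₀) c
        ≡⟨ cong (λ b → σ * (if b then 0ℚ else σ * g (add (del s e₀) e₀ , c))) (lookup∘update e₀ s false) ⟩
          σ * (σ * g (add (del s e₀) e₀ , c))
        ≡⟨ cong (λ x → σ * (σ * g (x , c))) ([]≔-restore s e₀ false true se₀) ⟩
          σ * (σ * g (s , c))
        ≡⟨ ℚP.*-assoc σ σ (g (s , c)) ⟨
          (σ * σ) * g (s , c)
        ≡⟨ trans (cong (_* g (s , c)) (sign-sq (nse (del s e₀) e₀))) (ℚP.*-identityˡ (g (s , c))) ⟩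
          g (s , c)
        ∎
        where open ≡-Reasoning

    cocycle-through : ∀ g → Dχ g ≈ 0c → ∀ s c e₀ → isValid s c ≡ true → monochromatic c e₀ ≡ true → lookup s e₀ ≡ false →
      ∑Fin m (λ e → if lookup s e then sign (nse (add (del s e) e₀) e) * g (add (del s e) e₀ , c) else 0ℚ)
      ≡ - (sign (nse s e₀) * g (s , c))
    cocycle-through g cocycle s c e₀ valid mono se₀ =
      trans (solve 2 (λ x y → y := (x :+ y) :+ (:- x)) refl (σ * g (s , c)) (∑Fin m inner))
            (trans (cong (_+ - (σ * g (s , c))) cycle) (ℚP.+-identityˡ _))
      where
      open ≡-Reasoning
      σ : ℚ
      σ = sign (nse s e₀)
      inner : Fin m → ℚ
      inner e = if lookup s e then sign (nse (add (del s e) e₀) e) * g (add (del s e) e₀ , c) else 0ℚ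
      del-add-comm : ∀ {e} → e ≢ e₀ → del (add s e₀) e ≡ add (del s e) e₀
      del-add-comm {e} e≢e₀ = []≔-commutes s e₀ e (e≢e₀ ∘ sym)
      split : ∀ e → (if ⌊ e ≟ᶠ e₀ ⌋ then σ * g (s , c) else 0ℚ) + inner e
              ≡ (if lookup (add s e₀) e then sign (nse (del (add s e₀) e) e) * g (del (add s e₀) e , c) else 0ℚ)
      split e with e ≟ᶠ e₀
      ... | yes refl rewrite lookup∘update e s true | se₀ | []≔-restore s e true false se₀ = ℚP.+-identityʳ _
      ... | no  e≢e₀ rewrite lookup-[]≔-other s true (e≢e₀ ∘ sym) | del-add-comm e≢e₀ with lookup s e
      ...   | true  = ℚP.+-identityˡ (sign (nse (add (del s e) e₀) e) * g (add (del s e) e₀ , c))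
      ...   | false = refl
      point-sum : ∑Fin m (λ e → if ⌊ e ≟ᶠ e₀ ⌋ then σ * g (s , c) else 0ℚ) ≡ σ * g (s , c)
      point-sum = trans (∑Fin-point m _ e₀ (λ e e≢e₀ → cong (λ b → if b then σ * g (s , c) else 0ℚ) (⌊⌋-no (e ≟ᶠ e₀) e≢e₀)))
                        (cong (λ b → if b then σ * g (s , c) else 0ℚ) (⌊⌋-yes (e₀ ≟ᶠ e₀) refl))
      cycle : σ * g (s , c) + ∑Fin m inner ≡ 0ℚ
      cycle = begin
          σ * g (s , c) + ∑Fin m inner
        ≡⟨ cong (_+ ∑Fin m inner) point-sum ⟨
          ∑Fin m (λ e → if ⌊ e ≟ᶠ e₀ ⌋ then σ * g (s , c) else 0ℚ) + ∑Fin m inner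
        ≡⟨ ∑-+ (allFin m) _ inner ⟨
          ∑Fin m (λ e → (if ⌊ e ≟ᶠ e₀ ⌋ then σ * g (s , c) else 0ℚ) + inner e)
        ≡⟨ ∑-cong (allFin m) split ⟩
          ∑Fin m (λ e → if lookup (add s e₀) e then sign (nse (del (add s e₀) e) e) * g (del (add s e₀) e , c) else 0ℚ)
        ≡⟨ Dχ-at g (add s e₀) c (isValid-add s c e₀ valid mono) ⟨
          Dχ g (add s e₀ , c)
        ≡⟨ cocycle (add s e₀ , c) ⟩
          0ℚ
        ∎

    homotopy-e₀∉s : ∀ g → Dχ g ≈ 0c → ∀ s c e₀ → isValid s c ≡ true → monochromatic c e₀ ≡ true → lookup s e₀ ≡ false →
      ∑Fin m (homotopy-term g s c e₀) ≡ g (s , c)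
    homotopy-e₀∉s g cocycle s c e₀ valid mono se₀ = begin
        ∑Fin m (homotopy-term g s c e₀)
      ≡⟨ ∑-cong (allFin m) anticommute ⟩
        ∑Fin m (λ e → - σ * inner e)
      ≡⟨ ∑-*ˡ (allFin m) (- σ) inner ⟩
        - σ * ∑Fin m inner
      ≡⟨ cong (- σ *_) (cocycle-through g cocycle s c e₀ valid mono se₀) ⟩
        - σ * - (σ * g (s , c))
      ≡⟨ solve 2 (λ a x → (:- a) :* (:- (a :* x)) := (a :* a) :* x) refl σ (g (s , c)) ⟩
        (σ * σ) * g (s , c)
      ≡⟨ trans (cong (_* g (s , c)) (sign-sq (nse s e₀))) (ℚP.*-identityˡ (g (s , c))) ⟩
        g (s , c)
      ∎
      where
      open ≡-Reasoning
      σ : ℚ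
      σ = sign (nse s e₀)
      inner : Fin m → ℚ
      inner e = if lookup s e then sign (nse (add (del s e) e₀) e) * g (add (del s e) e₀ , c) else 0ℚ
      anticommute : ∀ e → homotopy-term g s c e₀ e ≡ - σ * inner e
      anticommute e with lookup s e in se
      ... | false = sym (ℚP.*-zeroʳ (- σ))
      ... | true  = begin
          sign (nse (del s e) e) * step-to e₀ g (del s e) c
        ≡⟨ cong (λ b → sign (nse (del s e) e) * (if b then 0ℚ else sign (nse (del s e) e₀) * g (add (del s e) e₀ , c)))
                (trans (lookup-[]≔-other s false e≢e₀) se₀) ⟩
          sign (nse (del s e) e) * (sign (nse (del s e) e₀) * g (add (del s e) e₀ , c))
        ≡⟨ ℚP.*-assoc (sign (nse (del s e) e)) (sign (nse (del s e) e₀)) (g (add (del s e) e₀ , c)) ⟨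
          (sign (nse (del s e) e) * sign (nse (del s e) e₀)) * g (add (del s e) e₀ , c)
        ≡⟨ cong (_* g (add (del s e) e₀ , c)) (sign-anticommute s e e₀ se se₀ e≢e₀) ⟩
          - (σ * sign (nse (add (del s e) e₀) e)) * g (add (del s e) e₀ , c)
        ≡⟨ solve 3 (λ a b x → (:- (a :* b)) :* x := (:- a) :* (b :* x)) refl σ _ _ ⟩
          - σ * (sign (nse (add (del s e) e₀) e) * g (add (del s e) e₀ , c))
        ∎
        where
        e≢e₀ : e ≢ e₀
        e≢e₀ refl = false≢true (trans (sym se₀) se)

  Dχ-homotopy : ∀ g → Dχ g ≈ 0c → ∀ s c {e₀} → isValid s c ≡ true → pick c ≡ just e₀ → Dχ (homotopy g) (s , c) ≡ g (s , c)
  Dχ-homotopy g cocycle s c {e₀} valid picked =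
    trans (Dχ-at (homotopy g) s c valid) (trans (∑-cong (allFin m) unfold) (by-e₀ (lookup s e₀) refl))
    where
    unfold : ∀ e → (if lookup s e then sign (nse (del s e) e) * homotopy g (del s e , c) else 0ℚ) ≡ homotopy-term g s c e₀ e
    unfold e with lookup s e
    ... | false = refl
    ... | true  = cong (sign (nse (del s e) e) *_) (homotopy-at g (del s e) c (isValid-del s c e valid) picked)
    by-e₀ : ∀ b → lookup s e₀ ≡ b → ∑Fin m (homotopy-term g s c e₀) ≡ g (s , c)
    by-e₀ true  se₀ = homotopy-e₀∈s g s c e₀ se₀
    by-e₀ false se₀ = homotopy-e₀∉s g cocycle s c e₀ valid (pick-just c picked) se₀

  -- Cohomology

  ≈⇒-c≈0 : ∀ {f g : Cochain n m} → f ≈ g → (f -c g) ≈ 0c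
  ≈⇒-c≈0 {f} {g} f≈g S = trans (cong (ℚ._- g S) (f≈g S)) (ℚP.+-inverseʳ (g S))

  toChar-cocycle : ∀ f → OnValid f → D Γ f ≈ 0c → Dχ (toChar f) ≈ 0c
  toChar-cocycle f onValid Df≈0 S = begin
      Dχ (toChar f) S
    ≡⟨ toChar-fromChar (Dχ (toChar f)) (Dχ-onValid (toChar f)) S ⟨
      toChar (fromChar (Dχ (toChar f))) S
    ≡⟨ toChar-cong (λ T → sym (D∘fromChar (toChar f) T)) S ⟩
      toChar (D Γ (fromChar (toChar f))) S
    ≡⟨ toChar-cong (D-cong (fromChar-toChar f onValid)) S ⟩
      toChar (D Γ f) S
    ≡⟨ toChar-0 Df≈0 S ⟩
      0ℚ
    ∎
    where
    open ≡-Reasoning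

  InDim : ℕ → Cochain n m → Set
  InDim i f = ∀ s ℓ → count (lookup s) ≢ i → f (s , ℓ) ≡ 0ℚ

  InC⇒OnValid : ∀ {i b f} → InC Γ i b f → OnValid f
  InC⇒OnValid inC s ℓ invalid with inC (s , ℓ)
  ... | inj₁ f≡0          = f≡0
  ... | inj₂ (valid , _) = ⊥-elim (false≢true (trans (sym invalid) (invariant⇒isValid s ℓ valid)))

  InC⇒InDim : ∀ {i b f} → InC Γ i b f → InDim i f
  InC⇒InDim inC s ℓ wrong-dim with inC (s , ℓ)
  ... | inj₁ f≡0           = f≡0
  ... | inj₂ (_ , dim≡ , _) = ⊥-elim (wrong-dim dim≡)

  InC-above : ∀ {i j f} S → InC Γ i (just j) f → ¬ (ℤ.+ deg Γ S ℤ.≤ j) → f S ≡ 0ℚ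
  InC-above S inC too-high with inC S
  ... | inj₁ vanishes    = vanishes
  ... | inj₂ (_ , _ , ok) = ⊥-elim (too-high ok)

  toChar-InDim : ∀ {i f} → InDim i f → InDim i (toChar f)
  toChar-InDim inDim s c wrong-dim = if-0 (isValid s c) (transform-0 s (λ ℓ _ → inDim s ℓ wrong-dim) c)

  fromChar-InDim : ∀ {i g} → InDim i g → InDim i (fromChar g)
  fromChar-InDim {g = g} inDim s ℓ wrong-dim = fromChar-0-at g s (λ c → inDim s c wrong-dim) ℓ

  fromChar-InC : ∀ {i g} → InDim i g → InC Γ i nothing (fromChar g)
  fromChar-InC {i} {g} inDim (s , ℓ) with count (lookup s) ℕ.≟ i
  ... | no  dim≢ = inj₁ (fromChar-InDim inDim s ℓ dim≢)
  ... | yes dim≡ = by-validity (isValid s ℓ) refl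
    where
    by-validity : ∀ b → isValid s ℓ ≡ b → fromChar g (s , ℓ) ≡ 0ℚ ⊎ (Valid Γ (s , ℓ) × dim (s , ℓ) ≡ i × DegOK nothing (deg Γ (s , ℓ)))
    by-validity true  valid   = inj₂ (isValid⇒invariant s ℓ valid , dim≡ , tt)
    by-validity false invalid = inj₁ (fromChar-onValid g s ℓ invalid)

  proper⇒no-edges : ∀ s c → isValid s c ≡ true → pick c ≡ nothing → ∀ e → lookup s e ≡ false
  proper⇒no-edges s c valid none e = ¬-not λ se →
    false≢true (trans (sym (pick-nothing c none e)) (⌊⌋-yes (_ ≟ᵇ _) (isValid⇒invariant s c valid e se)))

  Dχ-no-edges : ∀ g s c → (∀ e → lookup s e ≡ false) → Dχ g (s , c) ≡ 0ℚ
  Dχ-no-edges g s c empty = if-0 (isValid s c) (∑-zero (allFin m) (λ e → cong (λ b → if b then sign (nse (del s e) e) * g (del s e , c) else 0ℚ) (empty e)))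

  homotopy-InDim : ∀ {i g} → InDim (suc i) g → InDim i (homotopy g)
  homotopy-InDim {i} {g} inDim s c dim≢ with isValid s c | pick c
  ... | false | _       = refl
  ... | true  | nothing = refl
  ... | true  | just e₀ with lookup s e₀ in se₀
  ...   | true  = refl
  ...   | false = trans (cong (sign (nse s e₀) *_) (inDim (add s e₀) c (λ dim≡ → dim≢ (ℕP.suc-injective (trans (sym (count-add s e₀ se₀)) dim≡)))))
                        (ℚP.*-zeroʳ (sign (nse s e₀)))

  char-cocycle-contractible : ∀ {i g} → Dχ g ≈ 0c → OnValid g → InDim (suc i) g → g ≈ Dχ (homotopy g)
  char-cocycle-contractible {i} {g} cocycle onValid inDim (s , c) = by-validity (isValid s c) refl
    where
    by-pick : isValid s c ≡ true → ∀ p → pick c ≡ p → g (s , c) ≡ Dχ (homotopy g) (s , c)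
    by-pick valid (just e₀) picked = sym (Dχ-homotopy g cocycle s c valid picked)
    by-pick valid nothing   none   =
      trans (inDim s c (λ dim≡ → ℕP.0≢1+n (trans (sym (count-none (lookup s) no-edges)) dim≡)))
            (sym (Dχ-no-edges (homotopy g) s c no-edges))
      where
      no-edges : ∀ e → lookup s e ≡ false
      no-edges = proper⇒no-edges s c valid none
    by-validity : ∀ b → isValid s c ≡ b → g (s , c) ≡ Dχ (homotopy g) (s , c)
    by-validity false invalid = trans (onValid s c invalid) (sym (Dχ-onValid (homotopy g) s c invalid))
    by-validity true  valid   = by-pick valid (pick c) refl

  H>0-vanishes : ∀ i b → HZero Γ (suc i) b
  H>0-vanishes i b f (inC , cocycle) = fromChar (homotopy g) , fromChar-InC (homotopy-InDim inDim) , D-preimage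
    where
    g : Cochain n m
    g = toChar f
    inDim : InDim (suc i) g
    inDim = toChar-InDim (InC⇒InDim inC)
    D-preimage : D Γ (fromChar (homotopy g)) ≈ f
    D-preimage S = begin
        D Γ (fromChar (homotopy g)) S
      ≡⟨ D∘fromChar (homotopy g) S ⟩
        fromChar (Dχ (homotopy g)) S
      ≡⟨ fromChar-cong (char-cocycle-contractible (toChar-cocycle f (InC⇒OnValid inC) cocycle) (toChar-onValid f) inDim) S ⟨
        fromChar g S
      ≡⟨ fromChar-toChar f (InC⇒OnValid inC) S ⟩
        f S
      ∎
      where open ≡-Reasoning

  char-cocycle-improper : ∀ {g} → Dχ g ≈ 0c → OnValid g → InDim 0 g → ∀ s c {e₀} → pick c ≡ just e₀ → g (s , c) ≡ 0ℚ
  char-cocycle-improper {g} cocycle onValid inDim s c picked = by-validity (isValid s c) refl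
    where
    by-validity : ∀ b → isValid s c ≡ b → g (s , c) ≡ 0ℚ
    by-validity false invalid = onValid s c invalid
    by-validity true  valid with count (lookup s) ℕ.≟ 0
    ... | no  dim≢ = inDim s c dim≢
    ... | yes dim≡ = trans (sym (Dχ-homotopy g cocycle s c valid picked))
                           (Dχ-no-edges (homotopy g) s c (count≡0⇒none (lookup s) dim≡))

  proper⇒bipartite : ∀ c → pick c ≡ nothing → Bipartite Γ
  proper⇒bipartite c none = lookup c , λ e mono → false≢true (trans (sym (pick-nothing c none e)) (⌊⌋-yes (_ ≟ᵇ _) mono))

  H⁰-vanishes-nonbipartite : ¬ Bipartite Γ → ∀ b → HZero Γ 0 b
  H⁰-vanishes-nonbipartite nonbipartite b f (inC , cocycle) S =
    trans (sym (fromChar-toChar f (InC⇒OnValid inC) S)) (fromChar-0 char≈0 S)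
    where
    char≈0 : toChar f ≈ 0c
    char≈0 (s , c) with pick c in picked
    ... | just e₀ = char-cocycle-improper (toChar-cocycle f (InC⇒OnValid inC) cocycle) (toChar-onValid f)
                                          (toChar-InDim (InC⇒InDim inC)) s c picked
    ... | nothing = ⊥-elim (nonbipartite (proper⇒bipartite c picked))

  H⁰≤n≡H⁰ : HFull Γ 0 (just (ℤ.+ n))
  H⁰≤n≡H⁰ f (inC , cocycle) = f , (bounded , cocycle) , ≈⇒-c≈0 {f} {f} (λ _ → refl)
    where
    bounded : InC Γ 0 (just (ℤ.+ n)) f
    bounded S with inC S
    ... | inj₁ vanishes           = inj₁ vanishes
    ... | inj₂ (valid , dim≡ , _) = inj₂ (valid , dim≡ , ℤ.+≤+ (count-≤ _))

  -- Connected bipartite graphs in degree zero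

  ∅ : Sub m
  ∅ = replicate m false

  isValid-∅ : ∀ c → isValid ∅ c ≡ true
  isValid-∅ c = invariant⇒isValid ∅ c (λ e ∅e → ⊥-elim (false≢true (trans (sym (lookup-replicate e false)) ∅e)))

  count-∅ : count (lookup ∅) ≡ 0
  count-∅ = count-none (lookup ∅) (λ e → lookup-replicate e false)

  count≡0⇒∅ : ∀ s → count (lookup s) ≡ 0 → s ≡ ∅
  count≡0⇒∅ s dim≡0 = vec-ext λ e → trans (count≡0⇒none (lookup s) dim≡0 e) (sym (lookup-replicate e false))

  isRep-∅ : ∀ v → isRep Γ ∅ v ≡ true
  isRep-∅ v = all-allFin⁻ _ no-smaller
    where
    no-smaller : ∀ y → not (y <ᶠ v ∧ lookup (comp Γ ∅ v) y) ≡ true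
    no-smaller y with lookup (comp Γ ∅ v) y in v-y
    ... | false = cong not (∧-zeroʳ (y <ᶠ v))
    ... | true with comp-sound ∅ v y v-y
    ...   | ε = cong (λ b → not (b ∧ true)) (⌊⌋-no (toℕ y ℕ.<? toℕ y) (ℕP.<-irrefl refl))
    ...   | edge e ∅e _ ◅ _ = ⊥-elim (false≢true (trans (sym (lookup-replicate e false)) ∅e))

  deg-∅ : ∀ ℓ → deg Γ (∅ , ℓ) ≡ count (lookup ℓ)
  deg-∅ ℓ = count-cong (λ v → trans (cong (lookup ℓ v ∧_) (isRep-∅ v)) (∧-identityʳ _))

  HIso⁰ : ∀ {b k} (g : (Fin k → ℚ) → Cochain n m) →
    (∀ a → Z Γ 0 b (g a)) →
    (∀ a a′ → g (λ t → a t + a′ t) ≈ (g a +c g a′)) →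
    (∀ x a → g (λ t → x * a t) ≈ (x ·c g a)) →
    (∀ a → g a ≈ 0c → ∀ t → a t ≡ 0ℚ) →
    (∀ f → Z Γ 0 b f → ∃ λ a → f ≈ g a) →
    HIso Γ 0 b k
  HIso⁰ g cocycle additive homogeneous injective surjective =
    g , cocycle , (λ a a′ → ≈⇒-c≈0 (additive a a′)) , (λ x a → ≈⇒-c≈0 (homogeneous x a)) , injective ,
    λ f z → let a , f≈ga = surjective f z in a , ≈⇒-c≈0 f≈ga

  module Bipartition (c₀ : Fin n → Bool) (proper₀ : ∀ e → c₀ (src Γ e) ≢ c₀ (tgt Γ e))
                     (v₀ : Fin n) (walk : ∀ u v → Star (Adj Γ) u v) where

    colouring : Bool → Sub n
    colouring b = tabulate λ w → b xor c₀ w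

    lookup-colouring : ∀ b w → lookup (colouring b) w ≡ b xor c₀ w
    lookup-colouring b w = lookup∘tabulate _ w

    colouring-proper : ∀ b → pick (colouring b) ≡ nothing
    colouring-proper b = pick-none (colouring b) λ e → ⌊⌋-no (_ ≟ᵇ _) λ mono →
      proper₀ e (xor-injectiveˡ b (trans (sym (lookup-colouring b (src Γ e))) (trans mono (lookup-colouring b (tgt Γ e)))))

    colouring-distinct : colouring false ≢ colouring true
    colouring-distinct eq = b≢not-b (trans (sym (lookup-colouring false v₀)) (trans (cong (λ c → lookup c v₀) eq) (lookup-colouring true v₀)))
      where
      b≢not-b : ∀ {b} → b ≢ not b
      b≢not-b {true}  ()
      b≢not-b {false} ()

    proper-unique : ∀ c → pick c ≡ nothing → c ≡ colouring (lookup c v₀ xor c₀ v₀)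
    proper-unique c none = vec-ext λ w → trans (along (walk v₀ w) base) (sym (lookup-colouring k w))
      where
      k : Bool
      k = lookup c v₀ xor c₀ v₀
      differs : ∀ e → lookup c (src Γ e) ≢ lookup c (tgt Γ e)
      differs e eq = false≢true (trans (sym (pick-nothing c none e)) (⌊⌋-yes (_ ≟ᵇ _) eq))
      across : ∀ {a b} → lookup c a ≢ lookup c b → c₀ a ≢ c₀ b → lookup c a ≡ k xor c₀ a → lookup c b ≡ k xor c₀ b
      across {a} {b} ca≢cb c₀a≢c₀b ca = begin
          lookup c b        ≡⟨ ¬-not (ca≢cb ∘ sym) ⟩
          not (lookup c a)  ≡⟨ cong not ca ⟩
          not (k xor c₀ a)  ≡⟨ not-distribʳ-xor k (c₀ a) ⟩
          k xor not (c₀ a)  ≡⟨ cong (k xor_) (¬-not (c₀a≢c₀b ∘ sym)) ⟨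
          k xor c₀ b        ∎
        where open ≡-Reasoning
      along : ∀ {a b} → Star (Adj Γ) a b → lookup c a ≡ k xor c₀ a → lookup c b ≡ k xor c₀ b
      along ε                              ca = ca
      along ((e , inj₁ (refl , refl)) ◅ p) ca = along p (across (differs e) (proper₀ e) ca)
      along ((e , inj₂ (refl , refl)) ◅ p) ca = along p (across (differs e ∘ sym) (proper₀ e ∘ sym) ca)
      base : lookup c v₀ ≡ k xor c₀ v₀
      base = sym (xor-xor (lookup c v₀) (c₀ v₀))

    C : Fin 2 → Sub n
    C fz      = colouring false
    C (fs fz) = colouring true

    coeff : (Fin 2 → ℚ) → Sub n → ℚ
    coeff a c = if c ≡ᵛ C fz then a fz else if c ≡ᵛ C (fs fz) then a (fs fz) else 0ℚ

    coeff-C : ∀ a t → coeff a (C t) ≡ a t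
    coeff-C a fz      rewrite ≡ᵛ-refl (C fz) = refl
    coeff-C a (fs fz) rewrite ≢⇒≡ᵛ-false (colouring-distinct ∘ sym) | ≡ᵛ-refl (C (fs fz)) = refl

    coeff-improper : ∀ a c {e₀} → pick c ≡ just e₀ → coeff a c ≡ 0ℚ
    coeff-improper a c picked with ≡-dec _≟ᵇ_ c (C fz) | ≡-dec _≟ᵇ_ c (C (fs fz))
    ... | yes refl | _        with () ← trans (sym picked) (colouring-proper false)
    ... | no _     | yes refl with () ← trans (sym picked) (colouring-proper true)
    ... | no _     | no _     = refl

    coeff-split : ∀ a c → coeff a c ≡ (if c ≡ᵛ C fz then a fz else 0ℚ) + (if c ≡ᵛ C (fs fz) then a (fs fz) else 0ℚ)
    coeff-split a c with ≡-dec _≟ᵇ_ c (C fz)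
    ... | yes refl rewrite ≢⇒≡ᵛ-false colouring-distinct = sym (ℚP.+-identityʳ _)
    ... | no  _ with c ≡ᵛ C (fs fz)
    ...   | true  = sym (ℚP.+-identityˡ _)
    ...   | false = refl

    char : (Fin 2 → ℚ) → Cochain n m
    char a (s , c) = if s ≡ᵛ ∅ then coeff a c else 0ℚ

    char-∅ : ∀ a c → char a (∅ , c) ≡ coeff a c
    char-∅ a c rewrite ≡ᵛ-refl ∅ = refl

    char-InDim : ∀ a → InDim 0 (char a)
    char-InDim a s c dim≢0 rewrite ≢⇒≡ᵛ-false {a = s} {∅} (λ s≡∅ → dim≢0 (trans (cong (λ x → count (lookup x)) s≡∅) count-∅)) = refl

    char-onValid : ∀ a → OnValid (char a)
    char-onValid a s c invalid rewrite ≢⇒≡ᵛ-false {a = s} {∅} (λ { refl → false≢true (trans (sym invalid) (isValid-∅ c)) }) = refl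

    char-Dχ : ∀ a → Dχ (char a) ≈ 0c
    char-Dχ a (t , c) with isValid t c in valid
    ... | false = refl
    ... | true  = ∑-zero (allFin m) term-0
      where
      term-0 : ∀ e → (if lookup t e then sign (nse (del t e) e) * char a (del t e , c) else 0ℚ) ≡ 0ℚ
      term-0 e with lookup t e in te
      ... | false = refl
      ... | true  = trans (cong (sign (nse (del t e) e) *_) (if-0 (del t e ≡ᵛ ∅) (coeff-0 (pick c) refl)))
                          (ℚP.*-zeroʳ (sign (nse (del t e) e)))
        where
        coeff-0 : ∀ p → pick c ≡ p → coeff a c ≡ 0ℚ
        coeff-0 (just _) picked = coeff-improper a c picked
        coeff-0 nothing  none   = ⊥-elim (false≢true (trans (sym (pick-nothing c none e))
                                                            (⌊⌋-yes (_ ≟ᵇ _) (isValid⇒invariant t c valid e te))))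

    char-+ : ∀ a a′ → char (λ t → a t + a′ t) ≈ (char a +c char a′)
    char-+ a a′ (s , c) with s ≡ᵛ ∅
    ... | false = sym (ℚP.+-identityˡ 0ℚ)
    ... | true with c ≡ᵛ C fz
    ...   | true = refl
    ...   | false with c ≡ᵛ C (fs fz)
    ...     | true  = refl
    ...     | false = sym (ℚP.+-identityˡ 0ℚ)

    char-· : ∀ x a → char (λ t → x * a t) ≈ (x ·c char a)
    char-· x a (s , c) with s ≡ᵛ ∅
    ... | false = sym (ℚP.*-zeroʳ x)
    ... | true with c ≡ᵛ C fz
    ...   | true = refl
    ...   | false with c ≡ᵛ C (fs fz)
    ...     | true  = refl
    ...     | false = sym (ℚP.*-zeroʳ x)

    char-cong : ∀ {a a′} → (∀ t → a t ≡ a′ t) → char a ≈ char a′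
    char-cong a≗a′ (s , c) = cong (λ x → if s ≡ᵛ ∅ then x else 0ℚ)
      (cong₂ (λ x y → if c ≡ᵛ C fz then x else if c ≡ᵛ C (fs fz) then y else 0ℚ) (a≗a′ fz) (a≗a′ (fs fz)))

    char-zero : char (λ _ → 0ℚ) ≈ 0c
    char-zero (s , c) with s ≡ᵛ ∅
    ... | false = refl
    ... | true with c ≡ᵛ C fz
    ...   | true = refl
    ...   | false with c ≡ᵛ C (fs fz)
    ...     | true  = refl
    ...     | false = refl

    basis : (Fin 2 → ℚ) → Cochain n m
    basis a = fromChar (char a)

    basis-cocycle : ∀ {b} a → (∀ S → DegOK b (deg Γ S) ⊎ basis a S ≡ 0ℚ) → Z Γ 0 b (basis a)
    basis-cocycle a degOK = in-C , λ S → trans (D∘fromChar (char a) S) (fromChar-0 (char-Dχ a) S)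
      where
      in-C : InC Γ 0 _ (basis a)
      in-C S with fromChar-InC (char-InDim a) S | degOK S
      ... | inj₁ vanishes           | _             = inj₁ vanishes
      ... | inj₂ _                  | inj₂ vanishes = inj₁ vanishes
      ... | inj₂ (valid , dim≡ , _) | inj₁ ok       = inj₂ (valid , dim≡ , ok)

    basis-injective : ∀ a → basis a ≈ 0c → ∀ t → a t ≡ 0ℚ
    basis-injective a basis≈0 t = begin
        a t                           ≡⟨ coeff-C a t ⟨
        coeff a (C t)                 ≡⟨ char-∅ a (C t) ⟨
        char a (∅ , C t)              ≡⟨ toChar-fromChar (char a) (char-onValid a) (∅ , C t) ⟨
        toChar (basis a) (∅ , C t)    ≡⟨ toChar-0 basis≈0 (∅ , C t) ⟩
        0ℚ                            ∎
      where open ≡-Reasoning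

    basis-surjective : ∀ {b} f → Z Γ 0 b f → f ≈ basis (λ t → toChar f (∅ , C t))
    basis-surjective f (inC , cocycle) S = trans (sym (fromChar-toChar f onValid S)) (fromChar-cong char-f S)
      where
      onValid : OnValid f
      onValid = InC⇒OnValid inC
      a : Fin 2 → ℚ
      a t = toChar f (∅ , C t)
      char-cocycle : Dχ (toChar f) ≈ 0c
      char-cocycle = toChar-cocycle f onValid cocycle
      at-∅ : ∀ c → isValid ∅ c ≡ true → ∀ p → pick c ≡ p → toChar f (∅ , c) ≡ coeff a c
      at-∅ c valid (just e₀) picked = trans (char-cocycle-improper char-cocycle (toChar-onValid f) (toChar-InDim (InC⇒InDim inC)) ∅ c picked)
                                            (sym (coeff-improper a c picked))
      at-∅ c valid nothing none with lookup c v₀ xor c₀ v₀ | proper-unique c none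
      ... | false | refl = sym (coeff-C a fz)
      ... | true  | refl = sym (coeff-C a (fs fz))
      char-f : toChar f ≈ char a
      char-f (s , c) with count (lookup s) ℕ.≟ 0
      ... | no  dim≢0 = trans (toChar-InDim (InC⇒InDim inC) s c dim≢0) (sym (char-InDim a s c dim≢0))
      ... | yes dim≡0 with refl ← count≡0⇒∅ s dim≡0 = trans (at-∅ c (isValid-∅ c) (pick c) refl) (sym (char-∅ a c))

    basis-cong : ∀ {a a′} → (∀ t → a t ≡ a′ t) → basis a ≈ basis a′
    basis-cong a≗a′ = fromChar-cong (char-cong a≗a′)

    basis-+ : ∀ a a′ → basis (λ t → a t + a′ t) ≈ (basis a +c basis a′)
    basis-+ a a′ S = trans (fromChar-cong (char-+ a a′) S) (fromChar-+ (char a) (char a′) S)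

    basis-· : ∀ x a → basis (λ t → x * a t) ≈ (x ·c basis a)
    basis-· x a S = trans (fromChar-cong (char-· x a) S) (fromChar-· x (char a) S)

    basis-off-∅ : ∀ a s ℓ → s ≢ ∅ → basis a (s , ℓ) ≡ 0ℚ
    basis-off-∅ a s ℓ s≢∅ = fromChar-InDim (char-InDim a) s ℓ (s≢∅ ∘ count≡0⇒∅ s)

    χ-C-true : ∀ ℓ → χ ∅ ℓ (C (fs fz)) ≡ χ ∅ ℓ (C fz) * sgn (parity (lookup ℓ))
    χ-C-true ℓ = trans (cong sgn (trans (parity-cong pointwise) (parity-xor _ (lookup ℓ))))
                       (sgn-xor (pairing ∅ ℓ (C fz)) (parity (lookup ℓ)))
      where
      pointwise : ∀ w → isRep Γ ∅ w ∧ (lookup ℓ w ∧ lookup (C (fs fz)) w)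
                      ≡ (isRep Γ ∅ w ∧ (lookup ℓ w ∧ lookup (C fz) w)) xor lookup ℓ w
      pointwise w rewrite isRep-∅ w | lookup-colouring true w | lookup-colouring false w = ∧-not (lookup ℓ w) (c₀ w)

    basis-at-∅ : ∀ a ℓ → basis a (∅ , ℓ) ≡ M⁻¹ ∅ * (χ ∅ ℓ (C fz) * (a fz + sgn (parity (lookup ℓ)) * a (fs fz)))
    basis-at-∅ a ℓ rewrite isValid-∅ ℓ = cong (M⁻¹ ∅ *_) (begin
        transform ∅ (λ c → char a (∅ , c)) ℓ
      ≡⟨ transform-cong ∅ (λ c _ → trans (char-∅ a c) (coeff-split a c)) ℓ ⟩
        transform ∅ (λ c → (if c ≡ᵛ C fz then a fz else 0ℚ) + (if c ≡ᵛ C (fs fz) then a (fs fz) else 0ℚ)) ℓ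
      ≡⟨ transform-+ ∅ _ _ ℓ ⟩
        transform ∅ (λ c → if c ≡ᵛ C fz then a fz else 0ℚ) ℓ + transform ∅ (λ c → if c ≡ᵛ C (fs fz) then a (fs fz) else 0ℚ) ℓ
      ≡⟨ cong₂ _+_ (transform-point ∅ (C fz) (a fz) ℓ (isValid-∅ (C fz))) (transform-point ∅ (C (fs fz)) (a (fs fz)) ℓ (isValid-∅ (C (fs fz)))) ⟩
        χ ∅ ℓ (C fz) * a fz + χ ∅ ℓ (C (fs fz)) * a (fs fz)
      ≡⟨ cong (λ x → χ ∅ ℓ (C fz) * a fz + x * a (fs fz)) (χ-C-true ℓ) ⟩
        χ ∅ ℓ (C fz) * a fz + (χ ∅ ℓ (C fz) * sgn (parity (lookup ℓ))) * a (fs fz)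
      ≡⟨ solve 4 (λ x a p b → x :* a :+ (x :* p) :* b := x :* (a :+ p :* b)) refl (χ ∅ ℓ (C fz)) (a fz) (sgn (parity (lookup ℓ))) (a (fs fz)) ⟩
        χ ∅ ℓ (C fz) * (a fz + sgn (parity (lookup ℓ)) * a (fs fz))
      ∎)
      where open ≡-Reasoning

    basis-at-∅≡0 : ∀ a ℓ → basis a (∅ , ℓ) ≡ 0ℚ → a fz + sgn (parity (lookup ℓ)) * a (fs fz) ≡ 0ℚ
    basis-at-∅≡0 a ℓ vanishes = begin
        r
      ≡⟨ solve 4 (λ M N σ X → X := (M :* σ) :* (N :* (σ :* X)) :+ (con 1ℚ :+ :- ((N :* M) :* (σ :* σ))) :* X) refl (M ∅) (M⁻¹ ∅) σ r ⟩
        (M ∅ * σ) * (M⁻¹ ∅ * (σ * r)) + (1ℚ + - ((M⁻¹ ∅ * M ∅) * (σ * σ))) * r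
      ≡⟨ cong₂ (λ u v → (M ∅ * σ) * u + (1ℚ + - (v * (σ * σ))) * r) (trans (sym (basis-at-∅ a ℓ)) vanishes) (M⁻¹*M ∅) ⟩
        (M ∅ * σ) * 0ℚ + (1ℚ + - (1ℚ * (σ * σ))) * r
      ≡⟨ cong (λ v → (M ∅ * σ) * 0ℚ + (1ℚ + - (1ℚ * v)) * r) (sgn-sq (pairing ∅ ℓ (C fz))) ⟩
        (M ∅ * σ) * 0ℚ + (1ℚ + - (1ℚ * 1ℚ)) * r
      ≡⟨ solve 3 (λ m s x → (m :* s) :* con 0ℚ :+ (con 1ℚ :+ :- (con 1ℚ :* con 1ℚ)) :* x := con 0ℚ) refl (M ∅) σ r ⟩
        0ℚ
      ∎
      where
      open ≡-Reasoning
      σ r : ℚ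
      σ = χ ∅ ℓ (C fz)
      r = a fz + sgn (parity (lookup ℓ)) * a (fs fz)

    H⁰≅ℚ² : HIso Γ 0 nothing 2
    H⁰≅ℚ² = HIso⁰ basis (λ a → basis-cocycle a (λ _ → inj₁ tt)) basis-+ basis-· basis-injective
                  (λ f z → (λ t → toChar f (∅ , C t)) , basis-surjective f z)

    𝟙 : Sub n
    𝟙 = replicate n true

    ℓ₁ : Sub n
    ℓ₁ = 𝟙 [ v₀ ]≔ false

    π : Bool
    π = parity (lookup 𝟙)

    parity-ℓ₁ : parity (lookup ℓ₁) ≡ π xor true
    parity-ℓ₁ = trans (parity-cong pointwise)
      (trans (parity-xor (lookup 𝟙) (λ w → ⌊ v₀ ≟ᶠ w ⌋)) (cong (π xor_) (trans (parity-point _ v₀ off) (⌊⌋-yes (v₀ ≟ᶠ v₀) refl))))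
      where
      pointwise : ∀ w → lookup ℓ₁ w ≡ lookup 𝟙 w xor ⌊ v₀ ≟ᶠ w ⌋
      pointwise w with v₀ ≟ᶠ w
      ... | yes refl rewrite lookup∘update v₀ 𝟙 false | lookup-replicate {n = n} v₀ true = refl
      ... | no  v₀≢w = trans (lookup-[]≔-other 𝟙 false v₀≢w) (sym (xor-identityʳ _))
      off : ∀ w → w ≢ v₀ → ⌊ v₀ ≟ᶠ w ⌋ ≡ false
      off w w≢v₀ = ⌊⌋-no (v₀ ≟ᶠ w) (w≢v₀ ∘ sym)

    count-𝟙 : count (lookup 𝟙) ≡ n
    count-𝟙 = count-all (lookup 𝟙) (λ w → lookup-replicate w true)

    deg-𝟙 : deg Γ (∅ , 𝟙) ≡ n
    deg-𝟙 = trans (deg-∅ 𝟙) count-𝟙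

    deg-ℓ₁ : deg Γ (∅ , ℓ₁) ℕ.+ 1 ≡ n
    deg-ℓ₁ = trans (cong (ℕ._+ 1) (deg-∅ ℓ₁)) (trans (ℕP.+-comm _ 1) (trans (sym one-less) count-𝟙))
      where
      one-less : count (lookup 𝟙) ≡ suc (count (lookup ℓ₁))
      one-less = count-insert (lookup ℓ₁) (lookup 𝟙) v₀ (lookup∘update v₀ 𝟙 false) (lookup-replicate v₀ true)
                              (λ i i≢v₀ → lookup-[]≔-other 𝟙 false (i≢v₀ ∘ sym))

    deg-below-𝟙 : ∀ ℓ → ℓ ≢ 𝟙 → deg Γ (∅ , ℓ) ℕ.+ 1 ≤ n
    deg-below-𝟙 ℓ ℓ≢𝟙 with w , differ ← vec-diff ℓ 𝟙 ℓ≢𝟙 =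
      subst (_≤ n) (trans (count-add ℓ w ℓ-w) (trans (ℕP.+-comm 1 (count (lookup ℓ))) (cong (ℕ._+ 1) (sym (deg-∅ ℓ)))))
            (count-≤ (lookup (add ℓ w)))
      where
      ℓ-w : lookup ℓ w ≡ false
      ℓ-w = ¬-not (λ ℓw → differ (trans ℓw (sym (lookup-replicate w true))))

    vanishes-at-𝟙 : ∀ k {f} → InC Γ 0 (just (ℤ.+ n ℤ.- ℤ.+ suc k)) f → f (∅ , 𝟙) ≡ 0ℚ
    vanishes-at-𝟙 k inC = InC-above (∅ , 𝟙) inC (λ ok → ℕP.m+1+n≰m n (≤-minus⇒ n n (suc k) (subst (λ d → ℤ.+ d ℤ.≤ _) deg-𝟙 ok)))

    coefficients : Cochain n m → Fin 2 → ℚ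
    coefficients f t = toChar f (∅ , C t)

    relation : ∀ {b} f → Z Γ 0 b f → ∀ ℓ → f (∅ , ℓ) ≡ 0ℚ →
      coefficients f fz + sgn (parity (lookup ℓ)) * coefficients f (fs fz) ≡ 0ℚ
    relation f z ℓ f≡0 = basis-at-∅≡0 (coefficients f) ℓ (trans (sym (basis-surjective f z (∅ , ℓ))) f≡0)

    shifted : (Fin 1 → ℚ) → Fin 2 → ℚ
    shifted a fz      = a fz
    shifted a (fs fz) = - (sgn π * a fz)

    shifted-𝟙 : ∀ a → basis (shifted a) (∅ , 𝟙) ≡ 0ℚ
    shifted-𝟙 a = trans (basis-at-∅ (shifted a) 𝟙)
      (trans (cong (λ x → M⁻¹ ∅ * (χ ∅ 𝟙 (C fz) * x)) cancels)
             (trans (cong (M⁻¹ ∅ *_) (ℚP.*-zeroʳ (χ ∅ 𝟙 (C fz)))) (ℚP.*-zeroʳ (M⁻¹ ∅))))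
      where
      cancels : a fz + sgn π * (- (sgn π * a fz)) ≡ 0ℚ
      cancels = trans (solve 2 (λ x p → x :+ p :* (:- (p :* x)) := x :+ :- ((p :* p) :* x)) refl (a fz) (sgn π))
        (trans (cong (λ y → a fz + - (y * a fz)) (sgn-sq π))
               (trans (cong (λ y → a fz + - y) (ℚP.*-identityˡ (a fz))) (ℚP.+-inverseʳ (a fz))))

    shifted-degree : ∀ a S → DegOK (just (ℤ.+ n ℤ.- ℤ.+ 1)) (deg Γ S) ⊎ basis (shifted a) S ≡ 0ℚ
    shifted-degree a (s , ℓ) = by-state s ℓ (≡-dec _≟ᵇ_ s ∅) (≡-dec _≟ᵇ_ ℓ 𝟙)
      where
      by-state : ∀ s ℓ → Dec (s ≡ ∅) → Dec (ℓ ≡ 𝟙) →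
                 DegOK (just (ℤ.+ n ℤ.- ℤ.+ 1)) (deg Γ (s , ℓ)) ⊎ basis (shifted a) (s , ℓ) ≡ 0ℚ
      by-state s  ℓ  (no s≢∅)  _          = inj₂ (basis-off-∅ (shifted a) s ℓ s≢∅)
      by-state .∅ .𝟙 (yes refl) (yes refl) = inj₂ (shifted-𝟙 a)
      by-state .∅ ℓ  (yes refl) (no ℓ≢𝟙)   = inj₁ (⇒≤-minus (deg Γ (∅ , ℓ)) n 1 (deg-below-𝟙 ℓ ℓ≢𝟙))

    shifted-+ : ∀ a a′ t → shifted (λ t → a t + a′ t) t ≡ shifted a t + shifted a′ t
    shifted-+ a a′ fz      = refl
    shifted-+ a a′ (fs fz) = solve 3 (λ p x y → :- (p :* (x :+ y)) := :- (p :* x) :+ :- (p :* y)) refl (sgn π) (a fz) (a′ fz)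

    shifted-· : ∀ x a t → shifted (λ t → x * a t) t ≡ x * shifted a t
    shifted-· x a fz      = refl
    shifted-· x a (fs fz) = solve 3 (λ p x y → :- (p :* (x :* y)) := x :* (:- (p :* y))) refl (sgn π) x (a fz)

    shifted-surjective : ∀ f → Z Γ 0 (just (ℤ.+ n ℤ.- ℤ.+ 1)) f → f ≈ basis (shifted (λ _ → coefficients f fz))
    shifted-surjective f z@(inC , _) S = trans (basis-surjective f z S) (basis-cong b≗shifted S)
      where
      b : Fin 2 → ℚ
      b = coefficients f
      f-𝟙 : f (∅ , 𝟙) ≡ 0ℚ
      f-𝟙 = vanishes-at-𝟙 0 inC
      b≗shifted : ∀ t → b t ≡ shifted (λ _ → b fz) t
      b≗shifted fz      = refl
      b≗shifted (fs fz) = solve-second (sgn π) (b fz) (b (fs fz)) (sgn-sq π) (relation f z 𝟙 f-𝟙)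

    H⁰≤n-1≅ℚ : HIso Γ 0 (just (ℤ.+ n ℤ.- ℤ.+ 1)) 1
    H⁰≤n-1≅ℚ = HIso⁰ (basis ∘ shifted)
      (λ a → basis-cocycle (shifted a) (shifted-degree a))
      (λ a a′ S → trans (basis-cong (shifted-+ a a′) S) (basis-+ (shifted a) (shifted a′) S))
      (λ x a S → trans (basis-cong (shifted-· x a) S) (basis-· x (shifted a) S))
      (λ { a basis≈0 fz → basis-injective (shifted a) basis≈0 fz })
      (λ f z → (λ _ → coefficients f fz) , shifted-surjective f z)

    H⁰≤n-2≡0 : HZero Γ 0 (just (ℤ.+ n ℤ.- ℤ.+ 2))
    H⁰≤n-2≡0 f z@(inC , _) S = begin
        f S                     ≡⟨ basis-surjective f z S ⟩
        basis b S               ≡⟨ basis-cong b≗0 S ⟩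
        basis (λ _ → 0ℚ) S      ≡⟨ fromChar-0 char-zero S ⟩
        0ℚ                      ∎
      where
      open ≡-Reasoning
      b : Fin 2 → ℚ
      b = coefficients f
      f-𝟙 : f (∅ , 𝟙) ≡ 0ℚ
      f-𝟙 = vanishes-at-𝟙 1 inC
      f-ℓ₁ : f (∅ , ℓ₁) ≡ 0ℚ
      f-ℓ₁ = InC-above (∅ , ℓ₁) inC (λ ok → 2≰1 (ℕP.+-cancelˡ-≤ (deg Γ (∅ , ℓ₁)) 2 1
               (subst (deg Γ (∅ , ℓ₁) ℕ.+ 2 ≤_) (sym deg-ℓ₁) (≤-minus⇒ (deg Γ (∅ , ℓ₁)) n 2 ok))))
        where
        2≰1 : ¬ (2 ≤ 1)
        2≰1 (s≤s ())
      relation-ℓ₁ : b fz + (sgn π * - 1ℚ) * b (fs fz) ≡ 0ℚ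
      relation-ℓ₁ = subst (λ x → b fz + x * b (fs fz) ≡ 0ℚ) (trans (cong sgn parity-ℓ₁) (sgn-xor π true)) (relation f z ℓ₁ f-ℓ₁)
      b≗0 : ∀ t → b t ≡ 0ℚ
      b≗0 fz      = proj₁ (both-zero (sgn π) (b fz) (b (fs fz)) (sgn-sq π) (relation f z 𝟙 f-𝟙) relation-ℓ₁)
      b≗0 (fs fz) = proj₂ (both-zero (sgn π) (b fz) (b (fs fz)) (sgn-sq π) (relation f z 𝟙 f-𝟙) relation-ℓ₁)

open import Data.Integer using (ℤ; +_; _-_)
open import Data.Fin using (fromℕ<)

mainTheorem6 : ∀ {n m} (Γ : Graph n m) → Connected Γ →
    (¬ Bipartite Γ → ∀ (i : ℕ) (j : ℤ) → HZero Γ i (just j))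
    × (Bipartite Γ →
        (∀ (i : ℕ) (j : ℤ) → 1 ≤ i → HZero Γ i (just j))
        × HFull Γ 0 (just (+ n))
        × HIso Γ 0 nothing 2
        × HIso Γ 0 (just (+ n - + 1)) 1
        × HZero Γ 0 (just (+ n - + 2)))
mainTheorem6 {n} Γ (1≤n , walk) = non-bipartite , bipartite
  where
  non-bipartite : ¬ Bipartite Γ → ∀ i j → HZero Γ i (just j)
  non-bipartite not-bipartite zero    j = H⁰-vanishes-nonbipartite Γ not-bipartite (just j)
  non-bipartite _             (suc i) j = H>0-vanishes Γ i (just j)

  positive : ∀ i j → 1 ≤ i → HZero Γ i (just j)
  positive (suc i) j _ = H>0-vanishes Γ i (just j)

  bipartite : Bipartite Γ → (∀ i j → 1 ≤ i → HZero Γ i (just j)) × HFull Γ 0 (just (+ n)) × HIso Γ 0 nothing 2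
                          × HIso Γ 0 (just (+ n - + 1)) 1 × HZero Γ 0 (just (+ n - + 2))
  bipartite (c₀ , proper₀) = positive , H⁰≤n≡H⁰ Γ , H⁰≅ℚ² , H⁰≤n-1≅ℚ , H⁰≤n-2≡0
    where open Bipartition Γ c₀ proper₀ (fromℕ< 1≤n) walk
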